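{- Let $p\ge 3$ be a prime and $n=p^2$. Then the polytope $EL(n)$ has exactly $\frac{p^3-p}{4}$ vertices.
   Context: For an integer $n\ge 3$, let $K_n$ be the complete graph on vertex set $[n]=\{1,\dots,n\}$ with edge set $E_n$, and let $d=\lfloor n/2\rfloor$. The length of an edge $\{i,j\}$ is $\ell_{i,j}=\min\{|i-j|,\,n-|i-j|\}\in\{1,\dots,d\}$. For a Hamiltonian cycle $H$ on $K_n$, let $\chi_H\in\mathbb{R}^{E_n}$ be its edge-incidence vector. The symmetric TSP polytope is $STSP(n)=\mathrm{conv}\{\chi_H: H \text{ a Hamiltonian cycle of } K_n\}$. The edge-length polytope $EL(n)\subset\mathbb{R}^d$ is the image of $STSP(n)$ under the linear map $x\mapsto (t_1,\dots,t_d)$ with $t_i=\sum_{\{s,t\}\in E_n:\ \ell_{s,t}=i} x_{s,t}$; equivalently, $EL(n)$ is the convex hull of the edge-length vectors of Hamiltonian cycles of $K_n$. -}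

module Defs where

open import Data.Nat using (ℕ; zero; suc; _+_; _*_; _/_; _%_; _⊓_; _∸_; ∣_-_∣)
open import Data.Nat.DivMod using (m%n<n)
open import Data.Nat.Properties using (_≟_)
open import Data.Fin using (Fin; toℕ; fromℕ<)
open import Data.Fin.Permutation using (Permutation′; _⟨$⟩ʳ_)
open import Data.List using (List; length; filter; allFin)
open import Data.Vec using (Vec; tabulate; foldr; zipWith)
open import Data.Integer as ℤ using (ℤ; +_)
open import Data.Product using (Σ; ∃; _×_)
open import Relation.Binary.PropositionalEquality using (_≡_; _≢_)

-- Vertices of K_n are encoded as Fin n = {0,…,n-1} (i ↦ i+1 relabels [n]);
-- edge lengths are invariant under this shift.

edgeLen : (n : ℕ) → ℕ → ℕ → ℕ
edgeLen n i j = ∣ i - j ∣ ⊓ (n ∸ ∣ i - j ∣)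

next : ∀ {n} → Fin n → Fin n
next {suc m} i = fromℕ< (m%n<n (suc (toℕ i)) (suc m))

half : ℕ → ℕ
half n = n / 2

-- A Hamiltonian cycle of K_n is given by a cyclic ordering σ(0),σ(1),…,σ(n-1)
-- of its vertices (a permutation σ of Fin n); its edges are {σ(i), σ(i+1 mod n)}.
-- Edge-length vector: component k (k = 0,…,d-1) counts edges of length k+1.
lengthVector : (n : ℕ) → Permutation′ n → Vec ℕ (half n)
lengthVector n σ = tabulate λ k →
  length (filter (λ i → edgeLen n (toℕ (σ ⟨$⟩ʳ i)) (toℕ (σ ⟨$⟩ʳ next i)) ≟ suc (toℕ k))
                 (allFin n))

dot : ∀ {d} → Vec ℤ d → Vec ℕ d → ℤ
dot c v = foldr (λ _ → ℤ) ℤ._+_ (+ 0) (zipWith (λ a b → a ℤ.* (+ b)) c v)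

-- v is a vertex of EL(n) = conv{ lengthVector n σ }: v is one of the generating
-- points and is the unique maximiser over the generators of some linear functional
-- (equivalently, over the whole polytope).
IsVertexEL : (n : ℕ) → Vec ℕ (half n) → Set
IsVertexEL n v =
  (∃ λ (σ : Permutation′ n) → lengthVector n σ ≡ v) ×
  (∃ λ (c : Vec ℤ (half n)) →
     ∀ (σ : Permutation′ n) → lengthVector n σ ≢ v → dot c (lengthVector n σ) ℤ.< dot c v)

-- Write K for the edge lengths not divisible by p and M for the multiples of p.  A Hamiltonian cycle
-- of K_n, n = p², leaves every residue class modulo p somewhere, along an edge with length in K, so
-- at most n - p of its edges have length in M.  Hence, if ck and cm are the maxima of a functional c
-- over K and over M, the value of c on any length vector is at most n·ck or (n - p)·cm + p·ck, and
-- every vertex is n·e_k (k ∈ K) or (n - p)·e_m + p·e_k (m ∈ M, k ∈ K).  All of these are vertices: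
-- n·e_k is the length vector of i ↦ i·k, (n - p)·e_m + p·e_k that of a walk through p blocks of
-- steps ±m joined by steps k, and they are the unique maximisers of e_k and e_k + 2·e_m.  There are
-- (p² - p)/2 choices of k and (p - 1)/2 of m, so (p² - p)/2 · (1 + (p - 1)/2) = (p³ - p)/4 vertices.

module Submission where

open import Defs
open import Data.Nat using (ℕ; _*_; _^_; _∸_; _/_; _≤_)
open import Data.Nat.Primality using (Prime)
open import Data.Vec using (Vec)
open import Data.List using (List; length)
open import Data.List.Relation.Unary.All using (All)
open import Data.List.Relation.Unary.Unique.Propositional using (Unique)
open import Data.List.Membership.Propositional using (_∈_)
open import Data.Product using (∃; _×_)
open import Relation.Binary.PropositionalEquality using (_≡_)

import Algebra.Properties.CommutativeSemigroup as CommutativeSemigroupProperties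
import Algebra.Properties.Semiring.Sum as SemiringSum
open import Data.Bool using (true; false; if_then_else_)
open import Data.Fin as Fin using (Fin; zero; suc; toℕ; fromℕ<; _↑ˡ_; _↑ʳ_)
import Data.Fin.Properties as Fin
open import Data.Fin.Permutation using (Permutation′; permutation; _⟨$⟩ʳ_; _⟨$⟩ˡ_; inverseʳ; inverseˡ)
open import Data.Integer as ℤ using (ℤ; +_)
import Data.Integer.Properties as ℤ
import Data.Integer.Solver
open import Data.List as List using ([]; _∷_; _++_; filter; allFin; cartesianProductWith)
open import Data.List.Membership.Propositional.Properties
  using (∈-filter⁺; ∈-filter⁻; ∈-allFin; ∈-map⁺; ∈-map⁻; ∈-++⁺ˡ; ∈-++⁺ʳ; ∈-++⁻;
         ∈-cartesianProductWith⁺; ∈-cartesianProductWith⁻)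
open import Data.List.Properties using (length-++; length-map)
open import Data.List.Relation.Binary.Disjoint.Propositional using (Disjoint)
import Data.List.Relation.Unary.All as All
open import Data.List.Relation.Unary.All.Properties using (all-filter)
open import Data.List.Relation.Unary.Any using (index)
open import Data.List.Relation.Unary.Any.Properties using (lookup-index)
import Data.List.Relation.Unary.Unique.Propositional.Properties as Unique
open import Data.Nat using (zero; suc; pred; _+_; _%_; _⊓_; ∣_-_∣; _<_; NonZero; >-nonZero; >-nonZero⁻¹; z≤n; s≤s)
open import Data.Nat.Properties as ℕ
open import Data.Nat.DivMod
  using (m≡m%n+[m/n]*n; [m+kn]%n≡m%n; m<n⇒m%n≡m; m*n/n≡m; /-monoˡ-≤; +-distrib-/-∣ʳ; m<n⇒m/n≡0;
         m%n<n; m%n%n≡m%n; n%n≡0; m*n%n≡0; m<n*o⇒m/o<n; m/n*n≤m; m/n<m)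
open import Data.Nat.Divisibility
  using (_∣_; _∣?_; divides; ∣⇒≤; ∣-refl; ∣-trans; ∣m+n∣m⇒∣n; ∣m∣n⇒∣m+n; n∣m*n; m∣m*n; *-cancelˡ-∣;
         m%n≡0⇒n∣m; n∣m⇒m%n≡0)
open import Data.Nat.Primality using (euclidsLemma; prime⇒nonZero; prime⇒irreducible)
open import Data.Nat.Solver using (module +-*-Solver)
open import Data.Product using (_,_; proj₁; proj₂)
open import Data.Sum using (_⊎_; inj₁; inj₂)
open import Data.Vec as Vec using ([]; _∷_; lookup; tabulate)
import Data.Vec.Properties as Vec
open import Function using (_∘_; id; Injective)
open import Relation.Binary.PropositionalEquality using (refl; sym; trans; cong; cong₂; subst; subst₂; _≢_; module ≡-Reasoning)
open import Relation.Nullary using (Dec; does; yes; no; ¬_; ¬?; contradiction; _×-dec_)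
open import Relation.Nullary.Decidable using (dec-true; dec-false)
open import Relation.Unary using (Pred; Decidable)

open +-*-Solver using (solve; _:+_; _:*_; _:^_; _:=_; con)

module ℕΣ = SemiringSum ℕ.+-*-semiring
module ℤΣ = SemiringSum ℤ.+-*-semiring
open ℕΣ using (sum; sum-syntax; sum-cong-≗)
module ℕ+ = CommutativeSemigroupProperties ℕ.+-commutativeSemigroup
module ℤ+ = CommutativeSemigroupProperties ℤ.+-commutativeSemigroup

-- Finite sums and counting

𝟙 : ∀ {a} {P : Set a} → Dec P → ℕ
𝟙 P? = if does P? then 1 else 0

𝟙-yes : ∀ {a} {P : Set a} (P? : Dec P) → P → 𝟙 P? ≡ 1
𝟙-yes P? p = cong (λ b → if b then 1 else 0) (dec-true P? p)

𝟙-no : ∀ {a} {P : Set a} (P? : Dec P) → ¬ P → 𝟙 P? ≡ 0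
𝟙-no P? ¬p = cong (λ b → if b then 1 else 0) (dec-false P? ¬p)

𝟙-cong : ∀ {a b} {P : Set a} {Q : Set b} → (P → Q) → (Q → P) → (P? : Dec P) (Q? : Dec Q) → 𝟙 P? ≡ 𝟙 Q?
𝟙-cong P→Q Q→P (yes p) Q? = sym (𝟙-yes Q? (P→Q p))
𝟙-cong P→Q Q→P (no ¬p) Q? = sym (𝟙-no Q? (¬p ∘ Q→P))

𝟙≤1 : ∀ {a} {P : Set a} (P? : Dec P) → 𝟙 P? ≤ 1
𝟙≤1 (yes _) = s≤s z≤n
𝟙≤1 (no _)  = z≤n

𝟙≡1⇒ : ∀ {a} {P : Set a} (P? : Dec P) → 𝟙 P? ≡ 1 → P
𝟙≡1⇒ (yes p) _  = p
𝟙≡1⇒ (no _)  ()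

count : ∀ {n p} {P : Pred (Fin n) p} → Decidable P → ℕ
count {n} P? = ∑[ i < n ] 𝟙 (P? i)

δ : ∀ {d} → Fin d → Fin d → ℕ
δ k k′ = 𝟙 (toℕ k ℕ.≟ toℕ k′)

δ-refl : ∀ {d} (k : Fin d) → δ k k ≡ 1
δ-refl k = 𝟙-yes (toℕ k ℕ.≟ toℕ k) refl

δ-≢ : ∀ {d} {k k′ : Fin d} → k ≢ k′ → δ k k′ ≡ 0
δ-≢ k≢k′ = 𝟙-no (_ ℕ.≟ _) (k≢k′ ∘ Fin.toℕ-injective)

δ≤1 : ∀ {d} (k k′ : Fin d) → δ k k′ ≤ 1
δ≤1 k k′ = 𝟙≤1 (toℕ k ℕ.≟ toℕ k′)

δ≡1⇒≡ : ∀ {d} {k k′ : Fin d} → δ k k′ ≡ 1 → k ≡ k′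
δ≡1⇒≡ {k = k} {k′} = Fin.toℕ-injective ∘ 𝟙≡1⇒ (toℕ k ℕ.≟ toℕ k′)

∑ℤ-syntax : ∀ n → (Fin n → ℤ) → ℤ
∑ℤ-syntax _ = ℤΣ.sum

infixl 10 ∑ℤ-syntax
syntax ∑ℤ-syntax n (λ i → x) = ∑ℤ[ i < n ] x

∑-mono-≤ : ∀ {n} {f g : Fin n → ℕ} → (∀ i → f i ≤ g i) → sum f ≤ sum g
∑-mono-≤ {zero}  f≤g = z≤n
∑-mono-≤ {suc n} f≤g = +-mono-≤ (f≤g zero) (∑-mono-≤ (f≤g ∘ suc))

∑-const : ∀ n c → ∑[ i < n ] c ≡ n * c
∑-const zero    c = refl
∑-const (suc n) c = cong (_+_ c) (∑-const n c)

∑-mono-≤-equality : ∀ {n} {f g : Fin n → ℕ} → (∀ i → f i ≤ g i) → sum g ≤ sum f →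
                    ∀ i → f i ≡ g i
∑-mono-≤-equality {suc n} {f} {g} f≤g g≤f = λ
  { zero    → ℕ.≤-antisym (f≤g zero) head≤
  ; (suc i) → ∑-mono-≤-equality (f≤g ∘ suc) tail≤ i }
  where
  head≤ : g zero ≤ f zero
  head≤ = ℕ.+-cancelʳ-≤ (sum (f ∘ suc)) _ _ (≤-trans (+-mono-≤ ℕ.≤-refl (∑-mono-≤ (f≤g ∘ suc))) g≤f)
  tail≤ : sum (g ∘ suc) ≤ sum (f ∘ suc)
  tail≤ = +-cancelˡ-≤ (f zero) _ _ (≤-trans (+-mono-≤ (f≤g zero) ℕ.≤-refl) g≤f)

∑-one : ∀ n → ∑[ i < n ] 1 ≡ n
∑-one n = trans (∑-const n 1) (ℕ.*-identityʳ n)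

∑-zero : ∀ {n} {f : Fin n → ℕ} → (∀ i → f i ≡ 0) → sum f ≡ 0
∑-zero {n} f≡0 = trans (sum-cong-≗ f≡0) (trans (∑-const n 0) (ℕ.*-zeroʳ n))

∑-++ : ∀ m {n} (f : Fin (m + n) → ℕ) →
       sum f ≡ ∑[ i < m ] f (i ↑ˡ n) + ∑[ i < n ] f (m ↑ʳ i)
∑-++ zero    f = refl
∑-++ (suc m) f = trans (cong (_+_ (f zero)) (∑-++ m (f ∘ suc))) (sym (+-assoc (f zero) _ _))

count-complement : ∀ {n p} {P : Pred (Fin n) p} (P? : Decidable P) → count P? + count (¬? ∘ P?) ≡ n
count-complement {zero}  P? = refl
count-complement {suc n} P? with does (P? zero)
... | true  = cong suc (count-complement (P? ∘ suc))
... | false = trans (ℕ.+-suc _ _) (cong suc (count-complement (P? ∘ suc)))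

∑-if : ∀ {n p} {P : Pred (Fin n) p} (P? : Decidable P) a b →
       ∑[ i < n ] (if does (P? i) then a else b) ≡ count P? * a + count (¬? ∘ P?) * b
∑-if {zero}  P? a b = refl
∑-if {suc n} P? a b with does (P? zero)
... | true  = trans (cong (_+_ a) (∑-if (P? ∘ suc) a b)) (sym (+-assoc a _ _))
... | false = trans (cong (_+_ b) (∑-if (P? ∘ suc) a b)) (ℕ+.x∙yz≈y∙xz b (count (P? ∘ suc) * a) _)

∑ℤ-if : ∀ {n p} {P : Pred (Fin n) p} (P? : Decidable P) a b →
        ∑ℤ[ i < n ] (if does (P? i) then a else b) ≡ + count P? ℤ.* a ℤ.+ + count (¬? ∘ P?) ℤ.* b
∑ℤ-if {zero}  P? a b = refl
∑ℤ-if {suc n} P? a b with does (P? zero)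
... | true  = trans (cong (ℤ._+_ a) (∑ℤ-if (P? ∘ suc) a b))
                (trans (sym (ℤ.+-assoc a _ _)) (cong (ℤ._+ _) (sym (ℤ.suc-* (+ count (P? ∘ suc)) a))))
... | false = trans (cong (ℤ._+_ b) (∑ℤ-if (P? ∘ suc) a b))
                (trans (ℤ+.x∙yz≈y∙xz b (+ count (P? ∘ suc) ℤ.* a) (+ count (¬? ∘ P? ∘ suc) ℤ.* b))
                  (cong (ℤ._+_ (+ count (P? ∘ suc) ℤ.* a)) (sym (ℤ.suc-* (+ count (¬? ∘ P? ∘ suc)) b))))

length-filter-tabulate : ∀ {a p n} {A : Set a} {P : Pred A p} (P? : Decidable P) (f : Fin n → A) →
                         length (filter P? (List.tabulate f)) ≡ ∑[ i < n ] 𝟙 (P? (f i))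
length-filter-tabulate {n = zero}  P? f = refl
length-filter-tabulate {n = suc n} P? f with does (P? (f zero))
... | true  = cong suc (length-filter-tabulate P? (f ∘ suc))
... | false = length-filter-tabulate P? (f ∘ suc)

length-cartesianProductWith : ∀ {a b c} {A : Set a} {B : Set b} {C : Set c} (f : A → B → C) xs ys →
                              length (cartesianProductWith f xs ys) ≡ length xs * length ys
length-cartesianProductWith f []       ys = refl
length-cartesianProductWith f (x ∷ xs) ys =
  trans (length-++ (List.map (f x) ys)) (cong₂ _+_ (length-map (f x) ys) (length-cartesianProductWith f xs ys))

injective⇒surjective : ∀ {n} (f : Fin n → Fin n) → Injective _≡_ _≡_ f → ∀ y → ∃ λ x → f x ≡ y
injective⇒surjective {suc m} f f-injective y with Fin.any? (λ x → f x Fin.≟ y)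
... | yes found = found
... | no missed = contradiction (Fin.injective⇒≤ squeeze-injective) ℕ.1+n≰n
  where
  avoids : ∀ x → y ≢ f x
  avoids x y≡fx = missed (x , sym y≡fx)
  squeeze : Fin (suc m) → Fin m
  squeeze x = Fin.punchOut (avoids x)
  squeeze-injective : Injective _≡_ _≡_ squeeze
  squeeze-injective eq = f-injective (Fin.punchOut-injective (avoids _) (avoids _) eq)

injection⇒≤count : ∀ {m n p} {P : Pred (Fin n) p} (P? : Decidable P) (e : Fin m → Fin n) →
                   Injective _≡_ _≡_ e → (∀ r → P (e r)) → m ≤ count P?
injection⇒≤count {m} {n} P? e e-inj Pe =
  subst (m ≤_) (length-filter-tabulate P? id) (Fin.injective⇒≤ position-injective)
  where
  position : Fin m → Fin (length (filter P? (allFin n)))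
  position r = index (∈-filter⁺ P? (∈-allFin (e r)) (Pe r))
  position-injective : Injective _≡_ _≡_ position
  position-injective {r} {r′} eq = e-inj (begin
    e r                                        ≡⟨ lookup-index (∈-filter⁺ P? (∈-allFin (e r)) (Pe r)) ⟩
    List.lookup (filter P? (allFin n)) (position r)  ≡⟨ cong (List.lookup (filter P? (allFin n))) eq ⟩
    List.lookup (filter P? (allFin n)) (position r′) ≡⟨ lookup-index (∈-filter⁺ P? (∈-allFin (e r′)) (Pe r′)) ⟨
    e r′                                       ∎)
    where open ≡-Reasoning

∑ℤ-mono-≤ : ∀ {n} {f g : Fin n → ℤ} → (∀ i → f i ℤ.≤ g i) → ℤΣ.sum f ℤ.≤ ℤΣ.sum g
∑ℤ-mono-≤ {zero}  f≤g = ℤ.≤-refl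
∑ℤ-mono-≤ {suc n} f≤g = ℤ.+-mono-≤ (f≤g zero) (∑ℤ-mono-≤ (f≤g ∘ suc))

+-∑ : ∀ {n} (f : Fin n → ℕ) → + sum f ≡ ∑ℤ[ i < n ] (+ f i)
+-∑ {zero}  f = refl
+-∑ {suc n} f = cong (ℤ._+_ (+ f zero)) (+-∑ (f ∘ suc))

∑ℤ-pick : ∀ {n} (c : Fin n → ℤ) (k₀ : Fin n) → ∑ℤ[ k < n ] (c k ℤ.* + δ k₀ k) ≡ c k₀
∑ℤ-pick {suc n} c zero = begin
  c zero ℤ.* + 1 ℤ.+ rest  ≡⟨ cong₂ ℤ._+_ (ℤ.*-identityʳ (c zero)) rest≡0 ⟩
  c zero ℤ.+ + 0           ≡⟨ ℤ.+-identityʳ (c zero) ⟩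
  c zero                   ∎
  where
  open ≡-Reasoning
  rest = ∑ℤ[ k < n ] (c (suc k) ℤ.* + 0)
  rest≡0 : rest ≡ + 0
  rest≡0 = trans (ℤΣ.sum-cong-≗ (λ k → ℤ.*-zeroʳ (c (suc k)))) (ℤΣ.sum-replicate-zero n)
∑ℤ-pick {suc n} c (suc k₀) = begin
  c zero ℤ.* + 0 ℤ.+ rest  ≡⟨ cong (λ x → x ℤ.+ rest) (ℤ.*-zeroʳ (c zero)) ⟩
  + 0 ℤ.+ rest             ≡⟨ ℤ.+-identityˡ rest ⟩
  rest                     ≡⟨ ∑ℤ-pick (c ∘ suc) k₀ ⟩
  c (suc k₀)               ∎
  where
  open ≡-Reasoning
  rest = ∑ℤ[ k < n ] (c (suc k) ℤ.* + δ k₀ k)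

argmaxOn : ∀ {d q} {P : Pred (Fin d) q} (P? : Decidable P) (f : Fin d → ℤ) → ∃ P →
           ∃ λ b → P b × ∀ k → P k → f k ℤ.≤ f b
argmaxOn {d} {P = P} P? f (k₀ , Pk₀) = best , argmax-all f {P = P} Pk₀ (all-filter P? (allFin d)) , dominates
  where
  open import Data.List.Extrema ℤ.≤-totalOrder using (argmax; argmax-all; f[xs]≤f[argmax])
  best = argmax f k₀ (filter P? (allFin d))
  dominates : ∀ k → P k → f k ℤ.≤ f best
  dominates k Pk = All.lookup (f[xs]≤f[argmax] k₀ (filter P? (allFin d))) (∈-filter⁺ P? (∈-allFin k) Pk)

reweigh-≤ : ∀ {x y} a b → x ℤ.≤ y → + a ℤ.* x ℤ.+ + b ℤ.* y ℤ.≤ + (a + b) ℤ.* y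
reweigh-≤ {x} {y} a b x≤y = ℤ.≤-trans (ℤ.+-monoˡ-≤ (+ b ℤ.* y) (ℤ.*-monoˡ-≤-nonNeg (+ a) x≤y))
  (ℤ.≤-reflexive (trans (sym (ℤ.*-distribʳ-+ y (+ a) (+ b))) (cong (ℤ._* y) (sym (ℤ.pos-+ a b)))))

shift-≤ : ∀ {x y} a b e → y ℤ.≤ x → + a ℤ.* x ℤ.+ + (b + e) ℤ.* y ℤ.≤ + (a + e) ℤ.* x ℤ.+ + b ℤ.* y
shift-≤ {x} {y} a b e y≤x = begin
  + a ℤ.* x ℤ.+ + (b + e) ℤ.* y            ≡⟨ cong (λ z → + a ℤ.* x ℤ.+ z ℤ.* y) (ℤ.pos-+ b e) ⟩
  + a ℤ.* x ℤ.+ (+ b ℤ.+ + e) ℤ.* y        ≡⟨ regroup (+ a) (+ b) (+ e) x y ⟩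
  (+ a ℤ.* x ℤ.+ + b ℤ.* y) ℤ.+ + e ℤ.* y  ≤⟨ ℤ.+-monoʳ-≤ (+ a ℤ.* x ℤ.+ + b ℤ.* y) (ℤ.*-monoˡ-≤-nonNeg (+ e) y≤x) ⟩
  (+ a ℤ.* x ℤ.+ + b ℤ.* y) ℤ.+ + e ℤ.* x  ≡⟨ regroup′ (+ a) (+ b) (+ e) x y ⟩
  (+ a ℤ.+ + e) ℤ.* x ℤ.+ + b ℤ.* y        ≡⟨ cong (λ z → z ℤ.* x ℤ.+ + b ℤ.* y) (ℤ.pos-+ a e) ⟨
  + (a + e) ℤ.* x ℤ.+ + b ℤ.* y            ∎
  where
  open ℤ.≤-Reasoning
  open Data.Integer.Solver.+-*-Solver using () renaming (solve to solveℤ; _:+_ to _⊕_; _:*_ to _⊛_; _:=_ to _⊜_)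
  regroup : ∀ a b e x y → a ℤ.* x ℤ.+ (b ℤ.+ e) ℤ.* y ≡ (a ℤ.* x ℤ.+ b ℤ.* y) ℤ.+ e ℤ.* y
  regroup = solveℤ 5 (λ a b e x y → a ⊛ x ⊕ (b ⊕ e) ⊛ y ⊜ (a ⊛ x ⊕ b ⊛ y) ⊕ e ⊛ y) refl
  regroup′ : ∀ a b e x y → (a ℤ.* x ℤ.+ b ℤ.* y) ℤ.+ e ℤ.* x ≡ (a ℤ.+ e) ℤ.* x ℤ.+ b ℤ.* y
  regroup′ = solveℤ 5 (λ a b e x y → (a ⊛ x ⊕ b ⊛ y) ⊕ e ⊛ x ⊜ (a ⊕ e) ⊛ x ⊕ b ⊛ y) refl

countMultiples : (p : ℕ) .{{_ : NonZero p}} → ℕ → ℕ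
countMultiples p N = count {N} (λ i → p ∣? suc (toℕ i))

countMultiples-< : ∀ p .{{_ : NonZero p}} {r} → r < p → countMultiples p r ≡ 0
countMultiples-< p r<p = ∑-zero λ i → 𝟙-no (p ∣? _) (λ p∣ → <⇒≱ (≤-<-trans (Fin.toℕ<n i) r<p) (∣⇒≤ p∣))

countMultiples-self : ∀ p .{{_ : NonZero p}} → countMultiples p p ≡ 1
countMultiples-self (suc q) = begin
  countMultiples (suc q) (suc q)                              ≡⟨ ℕΣ.sum-init-last (λ i → 𝟙 (suc q ∣? suc (toℕ i))) ⟩
  ∑[ i < q ] 𝟙 (suc q ∣? suc (toℕ (Fin.inject₁ i))) + 𝟙 (suc q ∣? suc (toℕ (Fin.fromℕ q)))
    ≡⟨ cong₂ _+_ (sum-cong-≗ (λ (i : Fin q) → cong (λ x → 𝟙 (suc q ∣? suc x)) (Fin.toℕ-inject₁ i)))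
                 (cong (λ x → 𝟙 (suc q ∣? suc x)) (Fin.toℕ-fromℕ q)) ⟩
  countMultiples (suc q) q + 𝟙 (suc q ∣? suc q)
    ≡⟨ cong₂ _+_ (countMultiples-< (suc q) (n<1+n q)) (𝟙-yes (suc q ∣? suc q) ∣-refl) ⟩
  1                                                           ∎
  where open ≡-Reasoning

module _ (p : ℕ) .{{_ : NonZero p}} where

  countMultiples-+p : ∀ N → countMultiples p (p + N) ≡ 1 + countMultiples p N
  countMultiples-+p N = trans (∑-++ p (λ i → 𝟙 (p ∣? suc (toℕ i))))
    (cong₂ _+_ (trans (sum-cong-≗ first) (countMultiples-self p)) (sum-cong-≗ shifted))
    where
    first : ∀ (i : Fin p) → 𝟙 (p ∣? suc (toℕ (i ↑ˡ N))) ≡ 𝟙 (p ∣? suc (toℕ i))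
    first i = cong (λ x → 𝟙 (p ∣? suc x)) (Fin.toℕ-↑ˡ i N)
    shifted : ∀ (i : Fin N) → 𝟙 (p ∣? suc (toℕ (p ↑ʳ i))) ≡ 𝟙 (p ∣? suc (toℕ i))
    shifted i = trans (cong (λ x → 𝟙 (p ∣? suc x)) (Fin.toℕ-↑ʳ p i))
      (𝟙-cong (λ p∣ → ∣m+n∣m⇒∣n (subst (p ∣_) (sym (ℕ.+-suc p _)) p∣) ∣-refl)
              (λ p∣ → subst (p ∣_) (ℕ.+-suc p _) (∣m∣n⇒∣m+n ∣-refl p∣)) (p ∣? _) (p ∣? _))

  countMultiples-quotient : ∀ q {r} → r < p → countMultiples p (q * p + r) ≡ q
  countMultiples-quotient zero    r<p = countMultiples-< p r<p
  countMultiples-quotient (suc q) r<p =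
    trans (cong (countMultiples p) (+-assoc p (q * p) _))
      (trans (countMultiples-+p _) (cong suc (countMultiples-quotient q r<p)))

∑ℤ-const : ∀ n a → ∑ℤ[ i < n ] a ≡ + n ℤ.* a
∑ℤ-const zero    a = sym (ℤ.*-zeroˡ a)
∑ℤ-const (suc n) a = trans (cong (ℤ._+_ a) (∑ℤ-const n a)) (sym (ℤ.suc-* (+ n) a))

-- Congruences and edge lengths

-- Witnessed by x + k n = y + l n, so that no NonZero n is needed (unlike for _%_).
infix 4 _≡_mod_
data _≡_mod_ (x y n : ℕ) : Set where
  congruent : ∀ k l → x + k * n ≡ y + l * n → x ≡ y mod n

module _ {n : ℕ} where

  mod-reflexive : ∀ {x y} → x ≡ y → x ≡ y mod n
  mod-reflexive x≡y = congruent 0 0 (cong (_+ 0) x≡y)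

  mod-refl : ∀ {x} → x ≡ x mod n
  mod-refl = mod-reflexive refl

  mod-sym : ∀ {x y} → x ≡ y mod n → y ≡ x mod n
  mod-sym (congruent k l eq) = congruent l k (sym eq)

  mod-trans : ∀ {x y z} → x ≡ y mod n → y ≡ z mod n → x ≡ z mod n
  mod-trans {x} {y} {z} (congruent k l eq) (congruent k′ l′ eq′) = congruent (k + k′) (l′ + l) (begin
    x + (k + k′) * n      ≡⟨ shuffle x k k′ ⟩
    (x + k * n) + k′ * n  ≡⟨ cong (_+ k′ * n) eq ⟩
    (y + l * n) + k′ * n  ≡⟨ swap y l k′ ⟩
    (y + k′ * n) + l * n  ≡⟨ cong (_+ l * n) eq′ ⟩
    (z + l′ * n) + l * n  ≡⟨ shuffle z l′ l ⟨
    z + (l′ + l) * n      ∎)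
    where
    open ≡-Reasoning
    shuffle : ∀ a b c → a + (b + c) * n ≡ (a + b * n) + c * n
    shuffle a b c = solve 4 (λ a b c m → a :+ (b :+ c) :* m := (a :+ b :* m) :+ c :* m) refl a b c n
    swap : ∀ a b c → (a + b * n) + c * n ≡ (a + c * n) + b * n
    swap a b c = solve 4 (λ a b c m → (a :+ b :* m) :+ c :* m := (a :+ c :* m) :+ b :* m) refl a b c n

  mod-+ : ∀ {a b c e} → a ≡ b mod n → c ≡ e mod n → a + c ≡ b + e mod n
  mod-+ {a} {b} {c} {e} (congruent k l eq) (congruent k′ l′ eq′) = congruent (k + k′) (l + l′) (begin
    a + c + (k + k′) * n              ≡⟨ interchange a c k k′ ⟩
    (a + k * n) + (c + k′ * n)        ≡⟨ cong₂ _+_ eq eq′ ⟩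
    (b + l * n) + (e + l′ * n)        ≡⟨ interchange b e l l′ ⟨
    b + e + (l + l′) * n              ∎)
    where
    open ≡-Reasoning
    interchange : ∀ a c k k′ → a + c + (k + k′) * n ≡ (a + k * n) + (c + k′ * n)
    interchange a c k k′ = solve 5 (λ a c k k′ m → a :+ c :+ (k :+ k′) :* m := (a :+ k :* m) :+ (c :+ k′ :* m))
                                   refl a c k k′ n

  mod-+kn : ∀ x k → x + k * n ≡ x mod n
  mod-+kn x k = congruent 0 k (+-identityʳ (x + k * n))

  mod-+n : ∀ x → x + n ≡ x mod n
  mod-+n x = congruent 0 1 (trans (+-identityʳ _) (cong (_+_ x) (sym (+-identityʳ n))))

  mod-cancelʳ-+ : ∀ {x y} z → x + z ≡ y + z mod n → x ≡ y mod n
  mod-cancelʳ-+ {x} {y} z (congruent k l eq) = congruent k l (+-cancelʳ-≡ z _ _ (begin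
    x + k * n + z  ≡⟨ ℕ+.xy∙z≈xz∙y x (k * n) z ⟩
    x + z + k * n  ≡⟨ eq ⟩
    y + z + l * n  ≡⟨ ℕ+.xy∙z≈xz∙y y z (l * n) ⟩
    y + l * n + z  ∎))
    where open ≡-Reasoning

  mod⇒%≡% : ∀ {x y} .{{_ : NonZero n}} → x ≡ y mod n → x % n ≡ y % n
  mod⇒%≡% {x} {y} (congruent k l eq) = begin
    x % n              ≡⟨ [m+kn]%n≡m%n x k n ⟨
    (x + k * n) % n    ≡⟨ cong (_% n) eq ⟩
    (y + l * n) % n    ≡⟨ [m+kn]%n≡m%n y l n ⟩
    y % n              ∎
    where open ≡-Reasoning

  mod-cancelˡ-+ : ∀ {x y} z → z + x ≡ z + y mod n → x ≡ y mod n
  mod-cancelˡ-+ {x} {y} z zx≡zy =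
    mod-cancelʳ-+ z (mod-trans (mod-reflexive (+-comm x z)) (mod-trans zx≡zy (mod-reflexive (+-comm z y))))

  mod-<⇒≡ : ∀ {x y} → x < n → y < n → x ≡ y mod n → x ≡ y
  mod-<⇒≡ {x} {y} x<n y<n x≡y = begin
    x      ≡⟨ m<n⇒m%n≡m x<n ⟨
    x % n  ≡⟨ mod⇒%≡% x≡y ⟩
    y % n  ≡⟨ m<n⇒m%n≡m y<n ⟩
    y      ∎
    where
    open ≡-Reasoning
    instance _ = >-nonZero (≤-<-trans z≤n x<n)

  mod-% : ∀ x .{{_ : NonZero n}} → x % n ≡ x mod n
  mod-% x = congruent (x / n) 0 (trans (sym (m≡m%n+[m/n]*n x n)) (sym (+-identityʳ x)))

  %≡%⇒mod : ∀ {x y} .{{_ : NonZero n}} → x % n ≡ y % n → x ≡ y mod n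
  %≡%⇒mod {x} {y} eq = mod-trans (mod-sym (mod-% x)) (mod-trans (mod-reflexive eq) (mod-% y))

  mod-0⇒∣ : ∀ {x} → x ≡ 0 mod n → n ∣ x
  mod-0⇒∣ {x} (congruent k l eq) = ∣m+n∣m⇒∣n (divides l (trans (+-comm (k * n) x) eq)) (n∣m*n k)

  ∣⇒mod-0 : ∀ {x} → n ∣ x → x ≡ 0 mod n
  ∣⇒mod-0 (divides q eq) = congruent 0 q (trans (+-identityʳ _) eq)

  mod-∣ : ∀ {d x y} → d ∣ n → x ≡ y mod n → x ≡ y mod d
  mod-∣ {d} {x} {y} (divides c n≡cd) (congruent k l eq) = congruent (k * c) (l * c) (begin
    x + k * c * d   ≡⟨ cong (_+_ x) (trans (*-assoc k c d) (cong (k *_) (sym n≡cd))) ⟩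
    x + k * n       ≡⟨ eq ⟩
    y + l * n       ≡⟨ cong (_+_ y) (trans (cong (l *_) n≡cd) (sym (*-assoc l c d))) ⟩
    y + l * c * d   ∎)
    where open ≡-Reasoning

  *-mod⇒∣ : ∀ {a b c} → a ≤ b → a * c ≡ b * c mod n → n ∣ (b ∸ a) * c
  *-mod⇒∣ {a} {b} {c} a≤b ac≡bc = mod-0⇒∣ (mod-cancelʳ-+ (a * c) (mod-trans (mod-reflexive split) (mod-sym ac≡bc)))
    where
    split : (b ∸ a) * c + a * c ≡ b * c
    split = trans (sym (*-distribʳ-+ c (b ∸ a) a)) (cong (_* c) (m∸n+n≡m a≤b))

n∣m<n⇒m≡0 : ∀ {n m} → n ∣ m → m < n → m ≡ 0
n∣m<n⇒m≡0 {m = zero}  _   _   = refl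
n∣m<n⇒m≡0 {m = suc m} n∣m m<n = contradiction (∣⇒≤ n∣m) (<⇒≱ m<n)

*-cancelʳ-mod : ∀ {q a b c} → (∀ {t} → q ∣ t * c → q ∣ t) → a < q → b < q → a * c ≡ b * c mod q → a ≡ b
*-cancelʳ-mod {q} {a} {b} {c} cancel a<q b<q ac≡bc with ≤-total a b
... | inj₁ a≤b = ≤-antisym a≤b
  (m∸n≡0⇒m≤n (n∣m<n⇒m≡0 (cancel (*-mod⇒∣ a≤b ac≡bc)) (≤-<-trans (m∸n≤m b a) b<q)))
... | inj₂ b≤a = ≤-antisym
  (m∸n≡0⇒m≤n (n∣m<n⇒m≡0 (cancel (*-mod⇒∣ b≤a (mod-sym ac≡bc))) (≤-<-trans (m∸n≤m a b) a<q))) b≤a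

[r+q*m]/m≡q : ∀ {m q r} .{{_ : NonZero m}} → r < m → (r + q * m) / m ≡ q
[r+q*m]/m≡q {m} {q} {r} r<m = trans (+-distrib-/-∣ʳ r (n∣m*n q)) (cong₂ _+_ (m<n⇒m/n≡0 r<m) (m*n/n≡m q m))

[r+q*m]%m≡r : ∀ {m q r} .{{_ : NonZero m}} → r < m → (r + q * m) % m ≡ r
[r+q*m]%m≡r {m} {q} {r} r<m = trans ([m+kn]%n≡m%n r q m) (m<n⇒m%n≡m r<m)

m+m≡m*2 : ∀ m → m + m ≡ m * 2
m+m≡m*2 m = trans (cong (_+_ m) (sym (+-identityʳ m))) (*-comm 2 m)

+-self≤⇒≤half : ∀ {m n} → m + m ≤ n → m ≤ half n
+-self≤⇒≤half {m} {n} m+m≤n = subst (_≤ n / 2) (m*n/n≡m m 2) (/-monoˡ-≤ 2 (subst (_≤ n) (m+m≡m*2 m) m+m≤n))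

half+half≤ : ∀ m → half m + half m ≤ m
half+half≤ m = subst (_≤ m) (trans (*-comm (m / 2) 2) (cong (_+_ (m / 2)) (+-identityʳ (m / 2)))) (m/n*n≤m m 2)

∣distance⇒mod : ∀ {d x y} → d ∣ ∣ x - y ∣ → x ≡ y mod d
∣distance⇒mod {d} {x} {y} (divides c D≡cd) with ≤-total x y
... | inj₁ x≤y = congruent c 0 (begin
  x + c * d        ≡⟨ cong (_+_ x) D≡cd ⟨
  x + ∣ x - y ∣    ≡⟨ cong (_+_ x) (m≤n⇒∣m-n∣≡n∸m x≤y) ⟩
  x + (y ∸ x)      ≡⟨ m+[n∸m]≡n x≤y ⟩
  y                ≡⟨ +-identityʳ y ⟨
  y + 0            ∎)
  where open ≡-Reasoning
... | inj₂ y≤x = mod-sym (congruent c 0 (begin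
  y + c * d        ≡⟨ cong (_+_ y) D≡cd ⟨
  y + ∣ x - y ∣    ≡⟨ cong (_+_ y) (trans (∣-∣-comm x y) (m≤n⇒∣m-n∣≡n∸m y≤x)) ⟩
  y + (x ∸ y)      ≡⟨ m+[n∸m]≡n y≤x ⟩
  x                ≡⟨ +-identityʳ x ⟨
  x + 0            ∎))
  where open ≡-Reasoning

prime-cancel : ∀ {q c t} → Prime q → ¬ q ∣ c → q ∣ t * c → q ∣ t
prime-cancel {q} {c} {t} q-prime q∤c q∣tc with euclidsLemma t c q-prime q∣tc
... | inj₁ q∣t = q∣t
... | inj₂ q∣c = contradiction q∣c q∤c

primeSquare-cancel : ∀ {q c t} → Prime q → ¬ q ∣ c → q * q ∣ t * c → q * q ∣ t
primeSquare-cancel {q} {c} {t} q-prime q∤c q²∣tc with prime-cancel {t = t} q-prime q∤c (∣-trans (m∣m*n q) q²∣tc)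
... | divides t′ refl
  with prime-cancel {t = t′} q-prime q∤c (*-cancelˡ-∣ q ⦃ prime⇒nonZero q-prime ⦄ (subst (q * q ∣_) regroup q²∣tc))
  where
  regroup : t′ * q * c ≡ q * (t′ * c)
  regroup = trans (cong (_* c) (*-comm t′ q)) (*-assoc q t′ c)
...   | divides t″ refl = divides t″ (*-assoc t″ q q)

linearCongruence : ∀ {q e} → Prime q → ¬ q ∣ e → ∀ s → ∃ λ μ → μ < q × q ∣ s + μ * e
linearCongruence {q} {e} q-prime q∤e s = toℕ μ , Fin.toℕ<n μ , q∣s+μe
  where
  instance _ = prime⇒nonZero q-prime
  affine : Fin q → Fin q
  affine a = fromℕ< (m%n<n (s + toℕ a * e) q)
  affine-injective : Injective _≡_ _≡_ affine
  affine-injective {a} {b} eq = Fin.toℕ-injective (*-cancelʳ-mod (prime-cancel q-prime q∤e) (Fin.toℕ<n a) (Fin.toℕ<n b)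
    (mod-cancelˡ-+ s (%≡%⇒mod (trans (sym (Fin.toℕ-fromℕ< _)) (trans (cong toℕ eq) (Fin.toℕ-fromℕ< _))))))
  preimage = injective⇒surjective affine affine-injective (fromℕ< (>-nonZero⁻¹ q))
  μ = proj₁ preimage
  q∣s+μe : q ∣ s + toℕ μ * e
  q∣s+μe = m%n≡0⇒n∣m _ q (trans (sym (Fin.toℕ-fromℕ< _)) (trans (cong toℕ (proj₂ preimage)) (Fin.toℕ-fromℕ< _)))

module _ {n : ℕ} where

  edgeLen-sym : ∀ x y → edgeLen n x y ≡ edgeLen n y x
  edgeLen-sym x y = cong (λ D → D ⊓ (n ∸ D)) (∣-∣-comm x y)

  private
    ≤-complement : ∀ {t} → t + t ≤ n → t ≤ n ∸ t
    ≤-complement {t} t+t≤n = subst (_≤ n ∸ t) (m+n∸n≡m t t) (∸-monoˡ-≤ t t+t≤n)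

  edgeLen-via-distance : ∀ {x y t} → t + t ≤ n → ∣ x - y ∣ ≡ t → edgeLen n x y ≡ t
  edgeLen-via-distance t+t≤n D≡t = trans (cong (λ D → D ⊓ (n ∸ D)) D≡t) (m≤n⇒m⊓n≡m (≤-complement t+t≤n))

  edgeLen-via-wraparound : ∀ {x y t} → t + t ≤ n → ∣ x - y ∣ ≡ n ∸ t → edgeLen n x y ≡ t
  edgeLen-via-wraparound {x} {y} {t} t+t≤n D≡n-t = begin
    ∣ x - y ∣ ⊓ (n ∸ ∣ x - y ∣)  ≡⟨ cong (λ D → D ⊓ (n ∸ D)) D≡n-t ⟩
    (n ∸ t) ⊓ (n ∸ (n ∸ t))  ≡⟨ cong ((n ∸ t) ⊓_) (m∸[m∸n]≡n (≤-trans (m≤m+n t t) t+t≤n)) ⟩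
    (n ∸ t) ⊓ t              ≡⟨ m≥n⇒m⊓n≡n (≤-complement t+t≤n) ⟩
    t                        ∎
    where open ≡-Reasoning
  
  edgeLen-forward : ∀ {x y t} → x < n → y < n → t + t ≤ n → y ≡ x + t mod n → edgeLen n x y ≡ t
  edgeLen-forward {x} {y} {t} x<n y<n t+t≤n y≡x+t with x + t <? n
  ... | yes x+t<n = edgeLen-via-distance {x} {y} t+t≤n (begin
    ∣ x - y ∣      ≡⟨ cong ∣ x -_∣ (mod-<⇒≡ y<n x+t<n y≡x+t) ⟩
    ∣ x - x + t ∣  ≡⟨ ∣m-m+n∣≡n x t ⟩
    t              ∎)
    where open ≡-Reasoning
  ... | no x+t≮n = edgeLen-via-wraparound {x} {y} t+t≤n (begin
    ∣ x - y ∣  ≡⟨ cong ∣ x -_∣ (mod-<⇒≡ y<n r<n (mod-trans y≡x+t x+t≡r)) ⟩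
    ∣ x - r ∣  ≡⟨ ∣-∣-comm x r ⟩
    ∣ r - x ∣  ≡⟨ cong ∣ r -_∣ r+[n∸t]≡x ⟨
    ∣ r - r + (n ∸ t) ∣  ≡⟨ ∣m-m+n∣≡n r (n ∸ t) ⟩
    n ∸ t      ∎)
    where
    open ≡-Reasoning
    r = x + t ∸ n
    r+n≡x+t : r + n ≡ x + t
    r+n≡x+t = m∸n+n≡m (≮⇒≥ x+t≮n)
    x+t≡r : x + t ≡ r mod n
    x+t≡r = mod-trans (mod-reflexive (trans (sym r+n≡x+t) (cong (_+_ r) (sym (+-identityʳ n))))) (mod-+kn r 1)
    r<n : r < n
    r<n = +-cancelʳ-< n r n (subst (_< n + n) (sym r+n≡x+t) (+-mono-<-≤ x<n (≤-trans (m≤m+n t t) t+t≤n)))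
    r+[n∸t]≡x : r + (n ∸ t) ≡ x
    r+[n∸t]≡x = +-cancelʳ-≡ t _ _
      (trans (+-assoc r (n ∸ t) t) (trans (cong (_+_ r) (m∸n+n≡m (≤-trans (m≤m+n t t) t+t≤n))) r+n≡x+t))

  edgeLen-backward : ∀ {x y t} → x < n → y < n → t + t ≤ n → x ≡ y + t mod n → edgeLen n x y ≡ t
  edgeLen-backward {x} {y} x<n y<n t+t≤n x≡y+t = trans (edgeLen-sym x y) (edgeLen-forward y<n x<n t+t≤n x≡y+t)

  edgeLen-positive : ∀ {x y} → x < n → y < n → x ≢ y → 0 < edgeLen n x y
  edgeLen-positive {x} {y} x<n y<n x≢y = ⊓-glb (n≢0⇒n>0 (x≢y ∘ ∣m-n∣≡0⇒m≡n)) (m<n⇒0<n∸m D<n)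
    where
    D<n : ∣ x - y ∣ < n
    D<n = ≤-<-trans (∣m-n∣≤m⊔n x y) (⊔-lub x<n y<n)

  edgeLen≤half : ∀ x y → x ≤ n → y ≤ n → edgeLen n x y ≤ half n
  edgeLen≤half x y x≤n y≤n = +-self≤⇒≤half (begin
    L + L                  ≤⟨ +-mono-≤ (m⊓n≤m D (n ∸ D)) (m⊓n≤n D (n ∸ D)) ⟩
    D + (n ∸ D)            ≡⟨ m+[n∸m]≡n (≤-trans (∣m-n∣≤m⊔n x y) (⊔-lub x≤n y≤n)) ⟩
    n                      ∎)
    where
    open ≤-Reasoning
    D = ∣ x - y ∣
    L = edgeLen n x y

  ∣edgeLen⇒mod : ∀ {d x y} → d ∣ n → x ≤ n → y ≤ n → d ∣ edgeLen n x y → x ≡ y mod d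
  ∣edgeLen⇒mod {d} {x} {y} d∣n x≤n y≤n d∣L with ⊓-sel ∣ x - y ∣ (n ∸ ∣ x - y ∣)
  ... | inj₁ L≡D   = ∣distance⇒mod (subst (d ∣_) L≡D d∣L)
  ... | inj₂ L≡n-D =
    ∣distance⇒mod (∣m+n∣m⇒∣n (subst (d ∣_) (sym (m∸n+n≡m D≤n)) d∣n) (subst (d ∣_) L≡n-D d∣L))
    where
    D≤n : ∣ x - y ∣ ≤ n
    D≤n = ≤-trans (∣m-n∣≤m⊔n x y) (⊔-lub x≤n y≤n)

-- Hamiltonian cycles as cyclic orders

toℕ-next : ∀ {n} .{{_ : NonZero n}} (i : Fin n) → toℕ (next i) ≡ suc (toℕ i) % n
toℕ-next {suc m} i = Fin.toℕ-fromℕ< _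

next-mod : ∀ {n} .{{_ : NonZero n}} (i : Fin n) → toℕ (next i) ≡ suc (toℕ i) mod n
next-mod i = mod-trans (mod-reflexive (toℕ-next i)) (mod-% _)

next≢ : ∀ {n} → 1 < n → (i : Fin n) → i ≢ next i
next≢ {n} 1<n i i≡next = ℕ.<⇒≱ 1<n (∣⇒≤ (mod-0⇒∣ (mod-sym (mod-cancelʳ-+ (toℕ i) i≡i+1))))
  where
  instance _ = >-nonZero (<-≤-trans (s≤s z≤n) 1<n)
  i≡i+1 : 0 + toℕ i ≡ 1 + toℕ i mod n
  i≡i+1 = mod-trans (mod-reflexive (cong toℕ i≡next)) (next-mod i)

module _ {n} {q} {Q : Pred (Fin n) q} where

  closed-under-next : ∀ {i₀} → Q i₀ → (∀ i → Q i → Q (next i)) → ∀ j → Q j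
  closed-under-next {i₀} Qi₀ step j = subst Q (Fin.toℕ-injective reach) (Q-advance (n ∸ toℕ i₀ + toℕ j))
    where
    instance _ = >-nonZero (≤-<-trans z≤n (Fin.toℕ<n j))
    advance : ℕ → Fin n
    advance zero    = i₀
    advance (suc t) = next (advance t)
    Q-advance : ∀ t → Q (advance t)
    Q-advance zero    = Qi₀
    Q-advance (suc t) = step _ (Q-advance t)
    toℕ-advance : ∀ t → toℕ (advance t) ≡ toℕ i₀ + t mod n
    toℕ-advance zero    = mod-reflexive (sym (ℕ.+-identityʳ _))
    toℕ-advance (suc t) = mod-trans (next-mod (advance t))
      (mod-trans (mod-+ (mod-refl {x = 1}) (toℕ-advance t)) (mod-reflexive (sym (ℕ.+-suc _ t))))
    arithmetic : toℕ i₀ + (n ∸ toℕ i₀ + toℕ j) ≡ toℕ j + n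
    arithmetic = trans (sym (ℕ.+-assoc (toℕ i₀) _ _))
      (trans (cong (_+ toℕ j) (ℕ.m+[n∸m]≡n (ℕ.<⇒≤ (Fin.toℕ<n i₀)))) (ℕ.+-comm n (toℕ j)))
    reach : toℕ (advance (n ∸ toℕ i₀ + toℕ j)) ≡ toℕ j
    reach = mod-<⇒≡ (Fin.toℕ<n _) (Fin.toℕ<n j)
      (mod-trans (toℕ-advance _) (mod-trans (mod-reflexive arithmetic) (mod-+n (toℕ j))))

  exit : Decidable Q → ∀ {i j} → Q i → ¬ Q j → ∃ λ k → Q k × ¬ Q (next k)
  exit Q? {i} {j} Qi ¬Qj with Fin.any? (λ k → Q? k ×-dec ¬? (Q? (next k)))
  ... | yes found = found
  ... | no none   = contradiction (closed-under-next Qi step j) ¬Qj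
    where
    step : ∀ k → Q k → Q (next k)
    step k Qk with Q? (next k)
    ... | yes Qk′ = Qk′
    ... | no ¬Qk′ = contradiction (k , Qk , ¬Qk′) none

edgeLength : (n : ℕ) → Permutation′ n → Fin n → ℕ
edgeLength n σ i = edgeLen n (toℕ (σ ⟨$⟩ʳ i)) (toℕ (σ ⟨$⟩ʳ next i))

dot-as-sum : ∀ {d} (c : Vec ℤ d) (v : Vec ℕ d) → dot c v ≡ ∑ℤ[ k < d ] (lookup c k ℤ.* + lookup v k)
dot-as-sum []       []       = refl
dot-as-sum (c ∷ cs) (v ∷ vs) = cong (ℤ._+_ (c ℤ.* + v)) (dot-as-sum cs vs)

module _ {n : ℕ} (1<n : 1 < n) (σ : Permutation′ n) where

  edgeLength-positive : ∀ i → 0 < edgeLength n σ i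
  edgeLength-positive i = edgeLen-positive (Fin.toℕ<n _) (Fin.toℕ<n _) (next≢ 1<n i ∘ σ-injective ∘ Fin.toℕ-injective)
    where
    σ-injective : ∀ {a b} → σ ⟨$⟩ʳ a ≡ σ ⟨$⟩ʳ b → a ≡ b
    σ-injective {a} {b} eq = trans (sym (inverseˡ σ)) (trans (cong (σ ⟨$⟩ˡ_) eq) (inverseˡ σ))

  private
    length-suc-pred : ∀ i → edgeLength n σ i ≡ suc (pred (edgeLength n σ i))
    length-suc-pred i = sym (ℕ.suc-pred _ ⦃ >-nonZero (edgeLength-positive i) ⦄)

  -- Opaque: a `with` whose goal mentions the length index of a concrete cycle would otherwise
  -- normalise the whole cycle, which exhausts memory.
  opaque
    lengthIndex : Fin n → Fin (half n)
    lengthIndex i = fromℕ< {pred (edgeLength n σ i)} (<-≤-trans (ℕ.n<1+n _) (subst (_≤ half n) (length-suc-pred i) ℓ≤d))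
      where
      ℓ≤d : edgeLength n σ i ≤ half n
      ℓ≤d = edgeLen≤half _ _ (<⇒≤ (Fin.toℕ<n (σ ⟨$⟩ʳ i))) (<⇒≤ (Fin.toℕ<n (σ ⟨$⟩ʳ next i)))

    suc-lengthIndex : ∀ i → suc (toℕ (lengthIndex i)) ≡ edgeLength n σ i
    suc-lengthIndex i = trans (cong suc (Fin.toℕ-fromℕ< _)) (sym (length-suc-pred i))

  lookup-lengthVector : ∀ k → lookup (lengthVector n σ) k ≡ ∑[ i < n ] δ (lengthIndex i) k
  lookup-lengthVector k = trans (Vec.lookup∘tabulate _ k)
    (trans (length-filter-tabulate (λ i → edgeLength n σ i ℕ.≟ suc (toℕ k)) id)
      (sum-cong-≗ λ i → cong (λ ℓ → 𝟙 (ℓ ℕ.≟ suc (toℕ k))) (sym (suc-lengthIndex i))))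

  lengthVector-≡ : ∀ {f} → (∀ k → ∑[ i < n ] δ (lengthIndex i) k ≡ f k) → lengthVector n σ ≡ tabulate f
  lengthVector-≡ counts = trans (sym (Vec.tabulate∘lookup _)) (Vec.tabulate-cong λ k → trans (lookup-lengthVector k) (counts k))

  dot-lengthVector : ∀ c → dot c (lengthVector n σ) ≡ ∑ℤ[ i < n ] lookup c (lengthIndex i)
  dot-lengthVector c = begin
    dot c (lengthVector n σ)                                    ≡⟨ dot-as-sum c _ ⟩
    ∑ℤ[ k < half n ] (lookup c k ℤ.* + lookup (lengthVector n σ) k)
      ≡⟨ ℤΣ.sum-cong-≗ (λ k → cong (λ x → lookup c k ℤ.* + x) (lookup-lengthVector k)) ⟩
    ∑ℤ[ k < half n ] (lookup c k ℤ.* + ∑[ i < n ] δ (lengthIndex i) k)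
      ≡⟨ ℤΣ.sum-cong-≗ (λ k → trans (cong (lookup c k ℤ.*_) (+-∑ (λ i → δ (lengthIndex i) k)))
                                    (ℤΣ.*-distribˡ-sum (lookup c k) (λ i → + δ (lengthIndex i) k))) ⟩
    ∑ℤ[ k < half n ] ∑ℤ[ i < n ] (lookup c k ℤ.* + δ (lengthIndex i) k)
      ≡⟨ ℤΣ.∑-comm (λ k i → lookup c k ℤ.* + δ (lengthIndex i) k) ⟩
    ∑ℤ[ i < n ] ∑ℤ[ k < half n ] (lookup c k ℤ.* + δ (lengthIndex i) k)
      ≡⟨ ℤΣ.sum-cong-≗ (λ i → ∑ℤ-pick (lookup c) (lengthIndex i)) ⟩
    ∑ℤ[ i < n ] lookup c (lengthIndex i)                        ∎
    where open ≡-Reasoning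

-- Opaque for the same reason as lengthIndex.
opaque
  permutationFromInjection : ∀ {n} (f : Fin n → Fin n) → Injective _≡_ _≡_ f → Permutation′ n
  permutationFromInjection f f-injective =
    permutation f (proj₁ ∘ preimage) (proj₂ ∘ preimage) (λ x → f-injective (proj₂ (preimage (f x))))
    where
    preimage : ∀ y → ∃ λ x → f x ≡ y
    preimage = injective⇒surjective f f-injective

  permutationFromInjection-apply : ∀ {n} (f : Fin n → Fin n) (f-injective : Injective _≡_ _≡_ f) i →
                                   permutationFromInjection f f-injective ⟨$⟩ʳ i ≡ f i
  permutationFromInjection-apply f f-injective i = refl

module WalkCycle {n : ℕ} .{{_ : NonZero n}} (f : ℕ → ℕ)
                 (f-injective : ∀ {a b} → a < n → b < n → f a ≡ f b mod n → a ≡ b) where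

  position : Fin n → Fin n
  position i = fromℕ< (m%n<n (f (toℕ i)) n)

  toℕ-position : ∀ i → toℕ (position i) ≡ f (toℕ i) mod n
  toℕ-position i = mod-trans (mod-reflexive (Fin.toℕ-fromℕ< _)) (mod-% _)

  position-injective : Injective _≡_ _≡_ position
  position-injective {i} {j} eq = Fin.toℕ-injective (f-injective (Fin.toℕ<n i) (Fin.toℕ<n j)
    (mod-trans (mod-sym (toℕ-position i)) (mod-trans (mod-reflexive (cong toℕ eq)) (toℕ-position j))))

  cycle : Permutation′ n
  cycle = permutationFromInjection position position-injective

  toℕ-cycle : ∀ i → toℕ (cycle ⟨$⟩ʳ i) ≡ f (toℕ i) mod n
  toℕ-cycle i = mod-trans (mod-reflexive (cong toℕ (permutationFromInjection-apply position position-injective i)))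
                          (toℕ-position i)

  module _ (closed : f n ≡ f 0 mod n) (i : Fin n) {t : ℕ} (t+t≤n : t + t ≤ n) where

    private
      toℕ-cycle-next : toℕ (cycle ⟨$⟩ʳ next i) ≡ f (suc (toℕ i)) mod n
      toℕ-cycle-next with suc (toℕ i) ℕ.<? n
      ... | yes i+1<n = mod-trans (toℕ-cycle (next i))
                          (mod-reflexive (cong f (trans (toℕ-next i) (m<n⇒m%n≡m i+1<n))))
      ... | no i+1≮n  = mod-trans (toℕ-cycle (next i)) (mod-trans (mod-reflexive (cong f wraps)) (mod-sym closed′))
        where
        i+1≡n : suc (toℕ i) ≡ n
        i+1≡n = ℕ.≤-antisym (Fin.toℕ<n i) (ℕ.≮⇒≥ i+1≮n)
        wraps : toℕ (next i) ≡ 0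
        wraps = trans (toℕ-next i) (trans (cong (_% n) i+1≡n) (n%n≡0 n))
        closed′ : f (suc (toℕ i)) ≡ f 0 mod n
        closed′ = subst (λ m → f m ≡ f 0 mod n) (sym i+1≡n) closed

    edgeLength-forward : f (suc (toℕ i)) ≡ f (toℕ i) + t mod n → edgeLength n cycle i ≡ t
    edgeLength-forward step = edgeLen-forward (Fin.toℕ<n _) (Fin.toℕ<n _) t+t≤n
      (mod-trans toℕ-cycle-next (mod-trans step (mod-+ (mod-sym (toℕ-cycle i)) mod-refl)))

    edgeLength-backward : f (toℕ i) ≡ f (suc (toℕ i)) + t mod n → edgeLength n cycle i ≡ t
    edgeLength-backward step = edgeLen-backward (Fin.toℕ<n _) (Fin.toℕ<n _) t+t≤n
      (mod-trans (toℕ-cycle i) (mod-trans step (mod-+ (mod-sym toℕ-cycle-next) mod-refl)))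

-- Each residue class modulo d is left somewhere along the cycle, by an edge whose length is not
-- divisible by d, and distinct classes are left along distinct edges.
crossingEdges : ∀ {n d} .{{_ : NonZero n}} → d ∣ n → 1 < d → (σ : Permutation′ n) →
                d ≤ count (λ i → ¬? (d ∣? edgeLength n σ i))
crossingEdges {n} {d} d∣n 1<d σ =
  injection⇒≤count (λ i → ¬? (d ∣? edgeLength n σ i)) exitOf exitOf-injective exitOf-crosses
  where
  instance _ = >-nonZero (<-≤-trans (s≤s z≤n) 1<d)
  residue : Fin n → ℕ
  residue i = toℕ (σ ⟨$⟩ʳ i) % d
  vertex : ∀ x → x % d < n
  vertex x = <-≤-trans (m%n<n x d) (∣⇒≤ d∣n)
  residue-anchor : ∀ x → residue (σ ⟨$⟩ˡ fromℕ< (vertex x)) ≡ x % d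
  residue-anchor x = trans (cong (λ v → toℕ v % d) (inverseʳ σ)) (trans (cong (_% d) (Fin.toℕ-fromℕ< _)) (m%n%n≡m%n x d))
  classExit : ∀ (r : Fin d) → ∃ λ i → residue i ≡ toℕ r × ¬ residue (next i) ≡ toℕ r
  classExit r = exit (λ i → residue i ℕ.≟ toℕ r)
    {σ ⟨$⟩ˡ fromℕ< (vertex (toℕ r))} {σ ⟨$⟩ˡ fromℕ< (vertex (suc (toℕ r)))}
    (trans (residue-anchor (toℕ r)) (m<n⇒m%n≡m (Fin.toℕ<n r)))
    (λ eq → ℕ.<⇒≱ 1<d (∣⇒≤ (mod-0⇒∣ (mod-cancelʳ-+ (toℕ r)
      (%≡%⇒mod (trans (sym (residue-anchor (suc (toℕ r)))) (trans eq (sym (m<n⇒m%n≡m (Fin.toℕ<n r))))))))))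
  exitOf : Fin d → Fin n
  exitOf r = proj₁ (classExit r)
  exitOf-injective : Injective _≡_ _≡_ exitOf
  exitOf-injective {r} {r′} eq = Fin.toℕ-injective
    (trans (sym (proj₁ (proj₂ (classExit r)))) (trans (cong residue eq) (proj₁ (proj₂ (classExit r′)))))
  exitOf-crosses : ∀ r → ¬ d ∣ edgeLength n σ (exitOf r)
  exitOf-crosses r d∣ℓ = proj₂ (proj₂ (classExit r))
    (trans (sym (mod⇒%≡% (∣edgeLen⇒mod d∣n (<⇒≤ (Fin.toℕ<n _)) (<⇒≤ (Fin.toℕ<n _)) d∣ℓ)))
           (proj₁ (proj₂ (classExit r))))

module _ {n : ℕ} (1<n : 1 < n) where

  cycleWeight : (Fin (half n) → ℕ) → Permutation′ n → ℕ
  cycleWeight g σ = ∑[ i < n ] g (lengthIndex 1<n σ i)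

  lengthIndex-≡ : ∀ {σ i k} → edgeLength n σ i ≡ suc (toℕ k) → lengthIndex 1<n σ i ≡ k
  lengthIndex-≡ {σ} {i} ℓ≡k+1 = Fin.toℕ-injective (ℕ.suc-injective (trans (suc-lengthIndex 1<n σ i) ℓ≡k+1))

  lengthVector-uniform : ∀ {σ k} → (∀ i → lengthIndex 1<n σ i ≡ k) →
                         lengthVector n σ ≡ tabulate (λ k′ → n * δ k k′)
  lengthVector-uniform {σ} {k} all-k = lengthVector-≡ 1<n σ λ k′ →
    trans (sum-cong-≗ (λ i → cong (λ x → δ x k′) (all-k i))) (∑-const n (δ k k′))

  lengthVector-twoValued : ∀ {σ k m q} {P : Pred (Fin n) q} (P? : Decidable P) →
    (∀ i → P i → lengthIndex 1<n σ i ≡ k) → (∀ i → ¬ P i → lengthIndex 1<n σ i ≡ m) →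
    lengthVector n σ ≡ tabulate (λ k′ → count P? * δ k k′ + count (¬? ∘ P?) * δ m k′)
  lengthVector-twoValued {σ} {k} {m} P? on-P off-P = lengthVector-≡ 1<n σ λ k′ →
    trans (sum-cong-≗ (λ i → indexed i k′)) (∑-if P? (δ k k′) (δ m k′))
    where
    indexed : ∀ i k′ → δ (lengthIndex 1<n σ i) k′ ≡ (if does (P? i) then δ k k′ else δ m k′)
    indexed i k′ with P? i
    ... | yes Pi = cong (λ x → δ x k′) (on-P i Pi)
    ... | no ¬Pi = cong (λ x → δ x k′) (off-P i ¬Pi)

  vertexByFunctional : ∀ (g : Fin (half n) → ℕ) σ₀ →
    (∀ σ → cycleWeight g σ ≤ cycleWeight g σ₀) →
    (∀ σ → cycleWeight g σ₀ ≤ cycleWeight g σ → lengthVector n σ ≡ lengthVector n σ₀) →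
    IsVertexEL n (lengthVector n σ₀)
  vertexByFunctional g σ₀ bounded equality-case = (σ₀ , refl) , (c , strict)
    where
    c = tabulate (λ k → + g k)
    dot-c : ∀ σ → dot c (lengthVector n σ) ≡ + cycleWeight g σ
    dot-c σ = trans (dot-lengthVector 1<n σ c)
      (trans (ℤΣ.sum-cong-≗ (λ i → Vec.lookup∘tabulate _ (lengthIndex 1<n σ i)))
             (sym (+-∑ (λ i → g (lengthIndex 1<n σ i)))))
    strict : ∀ σ → lengthVector n σ ≢ lengthVector n σ₀ → dot c (lengthVector n σ) ℤ.< dot c (lengthVector n σ₀)
    strict σ differs = subst₂ ℤ._<_ (sym (dot-c σ)) (sym (dot-c σ₀))
      (ℤ.+<+ (ℕ.≤∧≢⇒< (bounded σ) (λ eq → differs (equality-case σ (ℕ.≤-reflexive (sym eq))))))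


module Square (p : ℕ) (p-prime : Prime p) (3≤p : 3 ≤ p) where

  n : ℕ
  n = p * p

  d : ℕ
  d = half n

  instance
    p-nonZero : NonZero p
    p-nonZero = prime⇒nonZero p-prime
    n-nonZero : NonZero n
    n-nonZero = m*n≢0 p p

  1<p : 1 < p
  1<p = ≤-trans (s≤s (s≤s z≤n)) 3≤p

  1<n : 1 < n
  1<n = <-≤-trans 1<p (m≤m*n p p)

  p∣n : p ∣ n
  p∣n = m∣m*n p

  p+p<n : p + p < n
  p+p<n = subst (_< n) (sym (m+m≡m*2 p)) (*-monoʳ-< p (≤-trans (s≤s (s≤s (s≤s z≤n))) 3≤p))

  p<n∸p : p < n ∸ p
  p<n∸p = +-cancelʳ-< p p (n ∸ p) (subst (p + p <_) (sym (m∸n+n≡m (m≤m*n p p))) p+p<n)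

  p≤d : p ≤ d
  p≤d = +-self≤⇒≤half (<⇒≤ p+p<n)

  p-odd : ¬ 2 ∣ p
  p-odd 2∣p with prime⇒irreducible p-prime 2∣p
  ... | inj₁ ()
  ... | inj₂ 2≡p = <⇒≱ 3≤p (≤-reflexive (sym 2≡p))

  IsMultiple : Fin d → Set
  IsMultiple k = p ∣ suc (toℕ k)

  isMultiple? : Decidable IsMultiple
  isMultiple? k = p ∣? suc (toℕ k)

  pure : Fin d → Vec ℕ d
  pure k = tabulate (λ k′ → n * δ k k′)

  mixed : Fin d → Fin d → Vec ℕ d
  mixed m k = tabulate (λ k′ → (n ∸ p) * δ m k′ + p * δ k k′)

  length+length≤n : ∀ (k : Fin d) → suc (toℕ k) + suc (toℕ k) ≤ n
  length+length≤n k = ≤-trans (+-mono-≤ (Fin.toℕ<n k) (Fin.toℕ<n k)) (half+half≤ n)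

  -- Realising the candidate vertices

  module Uniform (k : Fin d) (k-unit : ¬ IsMultiple k) where

    s : ℕ
    s = suc (toℕ k)

    open WalkCycle (λ i → i * s) (*-cancelʳ-mod (primeSquare-cancel p-prime k-unit)) public

    closed : n * s ≡ 0 * s mod n
    closed = ∣⇒mod-0 (m∣m*n s)

    uniform : ∀ i → lengthIndex 1<n cycle i ≡ k
    uniform i = lengthIndex-≡ 1<n {cycle} {i}
      (edgeLength-forward closed i {s} (length+length≤n k) (mod-reflexive (+-comm s (toℕ i * s))))

  pure-realized : ∀ k (k-unit : ¬ IsMultiple k) → lengthVector n (Uniform.cycle k k-unit) ≡ pure k
  pure-realized k k-unit = lengthVector-uniform 1<n {Uniform.cycle k k-unit} (Uniform.uniform k k-unit)

  module Zigzag (m k : Fin d) (m-multiple : IsMultiple m) (k-unit : ¬ IsMultiple k) where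

    s t : ℕ
    s = suc (toℕ k)
    t = suc (toℕ m)

    j : ℕ
    j = _∣_.quotient m-multiple

    t≡jp : t ≡ j * p
    t≡jp = _∣_.equality m-multiple

    0<j : 0 < j
    0<j = n≢0⇒n>0 (λ j≡0 → 1+n≢0 (trans t≡jp (cong (_* p) j≡0)))

    j+j<p : j + j < p
    j+j<p = ≤∧≢⇒< (*-cancelʳ-≤ (j + j) p p 2j·p≤p·p)
                  (λ j+j≡p → p-odd (divides j (trans (sym j+j≡p) (m+m≡m*2 j))))
      where
      2j·p≤p·p : (j + j) * p ≤ p * p
      2j·p≤p·p = subst (_≤ n) (trans (cong₂ _+_ t≡jp t≡jp) (sym (*-distribʳ-+ p j j))) (length+length≤n m)

    e : ℕ
    e = p ∸ (j + j)

    j+[j+e]≡p : j + (j + e) ≡ p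
    j+[j+e]≡p = trans (sym (+-assoc j j e)) (m+[n∸m]≡n (<⇒≤ j+j<p))

    e-unit : ¬ p ∣ e
    e-unit p∣e = <⇒≢ (m<n⇒0<n∸m j+j<p)
                     (sym (n∣m<n⇒m≡0 p∣e (∸-monoʳ-< (≤-trans 0<j (m≤m+n j j)) (<⇒≤ j+j<p))))

  -- Position a * p + b (block a, offset b < p) is sent to blockStart a + b * p * u a.  Inside block a
  -- the walk moves by p * u a, which is +t (u a = j) or -t (u a = j + e = p - j) modulo n, and from
  -- the end of block a to the start of block a + 1 it moves by +s.  The first μ blocks go forwards,
  -- the rest backwards; the walk returns to its start after p blocks exactly when p ∣ s + μ * e.
  module ZigzagWalk (m k : Fin d) (m-multiple : IsMultiple m) (k-unit : ¬ IsMultiple k)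
                    (μ : ℕ) (μ<p : μ < p) (p∣s+μe : p ∣ Zigzag.s m k m-multiple k-unit + μ * Zigzag.e m k m-multiple k-unit)
                    where

    open Zigzag m k m-multiple k-unit

    u : ℕ → ℕ
    u a with a <? μ
    ... | yes _ = j
    ... | no _  = j + e

    u′ : ℕ → ℕ
    u′ a with a <? μ
    ... | yes _ = j + e
    ... | no _  = j

    u+u′≡p : ∀ a → u a + u′ a ≡ p
    u+u′≡p a with a <? μ
    ... | yes _ = j+[j+e]≡p
    ... | no _  = trans (+-comm (j + e) j) j+[j+e]≡p

    u-cases : ∀ a → u a ≡ j ⊎ u a ≡ j + e
    u-cases a with a <? μ
    ... | yes _ = inj₁ refl
    ... | no _  = inj₂ refl

    u-unit : ∀ a → ¬ p ∣ u a
    u-unit a p∣u with a <? μ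
    ... | yes _ = <⇒≢ 0<j (sym (n∣m<n⇒m≡0 p∣u (≤-trans (m≤m+n (suc j) j) j+j<p)))
    ... | no _  = <⇒≢ (≤-trans 0<j (m≤m+n j e)) (sym (n∣m<n⇒m≡0 p∣u j+e<p))
      where
      j+e<p : j + e < p
      j+e<p = subst (j + e <_) j+[j+e]≡p (m<n+m (j + e) 0<j)

    V : ℕ → ℕ
    V zero    = 0
    V (suc a) = V a + u′ a

    V-formula : ∀ a → V a ≡ a * j + (a ⊓ μ) * e
    V-formula zero    = refl
    V-formula (suc a) with a <? μ
    ... | yes a<μ = begin
      V a + (j + e)                    ≡⟨ cong (_+ (j + e)) (V-formula a) ⟩
      a * j + (a ⊓ μ) * e + (j + e)    ≡⟨ cong (λ x → a * j + x * e + (j + e)) (m≤n⇒m⊓n≡m (<⇒≤ a<μ)) ⟩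
      a * j + a * e + (j + e)          ≡⟨ solve 3 (λ a j e → a :* j :+ a :* e :+ (j :+ e) := (con 1 :+ a) :* j :+ (con 1 :+ a) :* e)
                                                refl a j e ⟩
      suc a * j + suc a * e            ≡⟨ cong (λ x → suc a * j + x * e) (m≤n⇒m⊓n≡m a<μ) ⟨
      suc a * j + (suc a ⊓ μ) * e      ∎
      where open ≡-Reasoning
    ... | no a≮μ = begin
      V a + j                          ≡⟨ cong (_+ j) (V-formula a) ⟩
      a * j + (a ⊓ μ) * e + j          ≡⟨ solve 3 (λ a j x → a :* j :+ x :+ j := (con 1 :+ a) :* j :+ x) refl a j ((a ⊓ μ) * e) ⟩
      suc a * j + (a ⊓ μ) * e          ≡⟨ cong (λ x → suc a * j + x * e) (trans (m≥n⇒m⊓n≡n μ≤a) (sym μ⊓)) ⟩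
      suc a * j + (suc a ⊓ μ) * e      ∎
      where
      open ≡-Reasoning
      μ≤a = ≮⇒≥ a≮μ
      μ⊓ : suc a ⊓ μ ≡ μ
      μ⊓ = m≥n⇒m⊓n≡n (m≤n⇒m≤1+n μ≤a)

    blockStart : ℕ → ℕ
    blockStart a = a * s + V a * p

    blockStart-suc : ∀ a → blockStart (suc a) ≡ blockStart a + s + u′ a * p
    blockStart-suc a = solve 5 (λ a s v w p → (con 1 :+ a) :* s :+ (v :+ w) :* p := a :* s :+ v :* p :+ s :+ w :* p)
                             refl a s (V a) (u′ a) p

    walk : ℕ → ℕ
    walk x = blockStart (x / p) + x % p * p * u (x / p)

    private
      suc-decomposition : ∀ x → suc x ≡ suc (x % p) + x / p * p
      suc-decomposition x = cong suc (m≡m%n+[m/n]*n x p)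

    walk-mod-p : ∀ x → walk x ≡ x / p * s mod p
    walk-mod-p x = mod-trans (mod-reflexive (regroup (x / p * s) (V a) (x % p) (u a))) (mod-+kn (x / p * s) (V a + x % p * u a))
      where
      a = x / p
      regroup : ∀ c v b w → c + v * p + b * p * w ≡ c + (v + b * w) * p
      regroup c v b w = solve 5 (λ c v b w q → c :+ v :* q :+ b :* q :* w := c :+ (v :+ b :* w) :* q) refl c v b w p

    walk-injective : ∀ {x y} → x < n → y < n → walk x ≡ walk y mod n → x ≡ y
    walk-injective {x} {y} x<n y<n walk≡ = begin
      x                  ≡⟨ m≡m%n+[m/n]*n x p ⟩
      x % p + x / p * p  ≡⟨ cong₂ (λ b a → b + a * p) same-offset same-block ⟩
      y % p + y / p * p  ≡⟨ m≡m%n+[m/n]*n y p ⟨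
      y                  ∎
      where
      open ≡-Reasoning
      same-block : x / p ≡ y / p
      same-block = *-cancelʳ-mod (prime-cancel p-prime k-unit) (m<n*o⇒m/o<n x<n) (m<n*o⇒m/o<n y<n)
        (mod-trans (mod-sym (walk-mod-p x)) (mod-trans (mod-∣ p∣n walk≡) (walk-mod-p y)))
      a = x / p
      offsets : x % p * p * u a ≡ y % p * p * u a mod n
      offsets = mod-cancelˡ-+ (blockStart a)
        (subst (λ a′ → walk x ≡ blockStart a′ + y % p * p * u a′ mod n) (sym same-block) walk≡)
      same-offset : x % p ≡ y % p
      same-offset = *-cancelʳ-≡ _ _ p (*-cancelʳ-mod (primeSquare-cancel p-prime (u-unit a))
        (*-monoˡ-< p (m%n<n x p)) (*-monoˡ-< p (m%n<n y p)) offsets)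

    walk-closed : walk n ≡ walk 0 mod n
    walk-closed = mod-trans (∣⇒mod-0 (divides (c + j) walk-n)) (mod-reflexive (sym walk-0))
      where
      open ≡-Reasoning
      c = _∣_.quotient p∣s+μe
      walk-0 : walk 0 ≡ 0
      walk-0 = cong₂ (λ a b → blockStart a + b * p * u a) (m<n⇒m/n≡0 (>-nonZero⁻¹ p)) (m<n⇒m%n≡m (>-nonZero⁻¹ p))
      walk-n : walk n ≡ (c + j) * (p * p)
      walk-n = begin
        walk n                                   ≡⟨ cong₂ (λ a b → blockStart a + b * p * u a) (m*n/n≡m p p) (m*n%n≡0 p p) ⟩
        p * s + V p * p + 0                      ≡⟨ cong (λ v → p * s + v * p + 0) (V-formula p) ⟩
        p * s + (p * j + (p ⊓ μ) * e) * p + 0    ≡⟨ cong (λ x → p * s + (p * j + x * e) * p + 0) (m≥n⇒m⊓n≡n (<⇒≤ μ<p)) ⟩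
        p * s + (p * j + μ * e) * p + 0          ≡⟨ solve 5 (λ p s j μ e → p :* s :+ (p :* j :+ μ :* e) :* p :+ con 0
                                                                  := (s :+ μ :* e) :* p :+ j :* (p :* p)) refl p s j μ e ⟩
        (s + μ * e) * p + j * (p * p)            ≡⟨ cong (λ x → x * p + j * (p * p)) (_∣_.equality p∣s+μe) ⟩
        c * p * p + j * (p * p)                  ≡⟨ cong (_+ j * (p * p)) (*-assoc c p p) ⟩
        c * (p * p) + j * (p * p)                ≡⟨ *-distribʳ-+ (p * p) c j ⟨
        (c + j) * (p * p)                        ∎

    walk-inner : ∀ x → suc (x % p) < p → walk (suc x) ≡ walk x + p * u (x / p)
    walk-inner x in-block = begin
      walk (suc x)                                 ≡⟨ cong₂ (λ a b → blockStart a + b * p * u a) suc-x/p suc-x%p ⟩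
      blockStart a + suc (x % p) * p * u a         ≡⟨ solve 4 (λ c b p w → c :+ (con 1 :+ b) :* p :* w := c :+ b :* p :* w :+ p :* w)
                                                            refl (blockStart a) (x % p) p (u a) ⟩
      blockStart a + x % p * p * u a + p * u a     ∎
      where
      open ≡-Reasoning
      a = x / p
      suc-x/p : suc x / p ≡ a
      suc-x/p = trans (cong (_/ p) (suc-decomposition x)) ([r+q*m]/m≡q {q = a} in-block)
      suc-x%p : suc x % p ≡ suc (x % p)
      suc-x%p = trans (cong (_% p) (suc-decomposition x)) ([r+q*m]%m≡r {q = a} in-block)

    walk-blockEnd : ∀ x → suc (x % p) ≡ p → walk (suc x) + u (x / p) * n ≡ walk x + s + 1 * n
    walk-blockEnd x block-end = begin
      walk (suc x) + u a * n                              ≡⟨ cong₂ (λ a′ b′ → blockStart a′ + b′ * p * u a′ + u a * n) suc-x/p suc-x%p ⟩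
      blockStart (suc a) + 0 + u a * n                    ≡⟨ cong (λ y → y + 0 + u a * n) (blockStart-suc a) ⟩
      blockStart a + s + u′ a * p + 0 + u a * (p * p)     ≡⟨ regroup (blockStart a + s) (u′ a * p) (u a * (p * p)) ⟩
      blockStart a + s + (u′ a * p + u a * (p * p))      ≡⟨ cong (_+_ (blockStart a + s)) wrap ⟩
      blockStart a + s + (b * p * u a + (u a + u′ a) * p) ≡⟨ regroup′ (blockStart a) s (b * p * u a) ((u a + u′ a) * p) ⟩
      walk x + s + (u a + u′ a) * p
        ≡⟨ cong (_+_ (walk x + s)) (trans (cong (_* p) (u+u′≡p a)) (sym (+-identityʳ (p * p)))) ⟩
      walk x + s + 1 * n                                  ∎
      where
      open ≡-Reasoning
      a = x / p
      b = x % p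
      suc-x≡ : suc x ≡ 0 + suc a * p
      suc-x≡ = trans (suc-decomposition x) (cong (_+ a * p) block-end)
      suc-x/p : suc x / p ≡ suc a
      suc-x/p = trans (cong (_/ p) suc-x≡) ([r+q*m]/m≡q {q = suc a} (>-nonZero⁻¹ p))
      suc-x%p : suc x % p ≡ 0
      suc-x%p = trans (cong (_% p) suc-x≡) ([r+q*m]%m≡r {q = suc a} (>-nonZero⁻¹ p))
      regroup : ∀ c y z → c + y + 0 + z ≡ c + (y + z)
      regroup c y z = solve 3 (λ c y z → c :+ y :+ con 0 :+ z := c :+ (y :+ z)) refl c y z
      regroup′ : ∀ c s y z → c + s + (y + z) ≡ c + y + s + z
      regroup′ c s y z = solve 4 (λ c s y z → c :+ s :+ (y :+ z) := c :+ y :+ s :+ z) refl c s y z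
      wrap : u′ a * p + u a * (p * p) ≡ b * p * u a + (u a + u′ a) * p
      wrap = subst (λ q → u′ a * q + u a * (q * q) ≡ b * q * u a + (u a + u′ a) * q) block-end
        (solve 3 (λ b w w′ → w′ :* (con 1 :+ b) :+ w :* ((con 1 :+ b) :* (con 1 :+ b))
                             := b :* (con 1 :+ b) :* w :+ (w :+ w′) :* (con 1 :+ b)) refl b (u a) (u′ a))

    open WalkCycle walk walk-injective public using (cycle)
    open WalkCycle walk walk-injective using (edgeLength-forward; edgeLength-backward)

    blockEnd-∣ : ∀ x → suc (x % p) ≡ p → p ∣ suc x
    blockEnd-∣ x block-end = divides (suc (x / p)) (trans (suc-decomposition x) (cong (_+ x / p * p) block-end))

    ∣-blockEnd : ∀ x → p ∣ suc x → suc (x % p) ≡ p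
    ∣-blockEnd x p∣x+1 with suc (x % p) <? p
    ... | no ≮p = ≤-antisym (m%n<n x p) (≮⇒≥ ≮p)
    ... | yes in-block = contradiction (trans (sym suc-x%p) (n∣m⇒m%n≡0 (suc x) p p∣x+1)) 1+n≢0
      where
      suc-x%p : suc x % p ≡ suc (x % p)
      suc-x%p = trans (cong (_% p) (suc-decomposition x)) ([r+q*m]%m≡r {q = x / p} in-block)

    lengthIndex-blockEnd : ∀ i → p ∣ suc (toℕ i) → lengthIndex 1<n cycle i ≡ k
    lengthIndex-blockEnd i p∣x+1 = lengthIndex-≡ 1<n {cycle} {i} (edgeLength-forward walk-closed i {s} (length+length≤n k)
      (congruent (u (toℕ i / p)) 1 (walk-blockEnd (toℕ i) (∣-blockEnd (toℕ i) p∣x+1))))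

    lengthIndex-inner : ∀ i → ¬ p ∣ suc (toℕ i) → lengthIndex 1<n cycle i ≡ m
    lengthIndex-inner i p∤x+1 = lengthIndex-≡ 1<n {cycle} {i} (direction (u-cases a))
      where
      x = toℕ i
      a = x / p
      step : walk (suc x) ≡ walk x + p * u a
      step = walk-inner x (≤∧≢⇒< (m%n<n x p) (p∤x+1 ∘ blockEnd-∣ x))
      direction : u a ≡ j ⊎ u a ≡ j + e → edgeLength n cycle i ≡ t
      direction (inj₁ u≡j) = edgeLength-forward walk-closed i {t} (length+length≤n m)
        (mod-reflexive (trans step (cong (_+_ (walk x)) (trans (cong (p *_) u≡j) (trans (*-comm p j) (sym t≡jp))))))
      direction (inj₂ u≡j+e) = edgeLength-backward walk-closed i {t} (length+length≤n m)
        (mod-sym (mod-trans (mod-reflexive wraps) (mod-+n (walk x))))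
        where
        open ≡-Reasoning
        wraps : walk (suc x) + t ≡ walk x + n
        wraps = begin
          walk (suc x) + t               ≡⟨ cong₂ _+_ step t≡jp ⟩
          walk x + p * u a + j * p       ≡⟨ cong (λ w → walk x + p * w + j * p) u≡j+e ⟩
          walk x + p * (j + e) + j * p   ≡⟨ solve 4 (λ w p j e → w :+ p :* (j :+ e) :+ j :* p := w :+ p :* (j :+ (j :+ e)))
                                                   refl (walk x) p j e ⟩
          walk x + p * (j + (j + e))     ≡⟨ cong (λ z → walk x + p * z) j+[j+e]≡p ⟩
          walk x + n                     ∎

  blockEnds : count {n} (λ i → p ∣? suc (toℕ i)) ≡ p
  blockEnds = trans (cong (countMultiples p) (sym (+-identityʳ n))) (countMultiples-quotient p p (>-nonZero⁻¹ p))

  innerSteps : count {n} (λ i → ¬? (p ∣? suc (toℕ i))) ≡ n ∸ p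
  innerSteps = trans (sym (m+n∸m≡n p inner))
    (cong (_∸ p) (trans (cong (_+ inner) (sym blockEnds)) (count-complement (λ i → p ∣? suc (toℕ i)))))
    where inner = count {n} (λ i → ¬? (p ∣? suc (toℕ i)))

  module Mixed (m k : Fin d) (m-multiple : IsMultiple m) (k-unit : ¬ IsMultiple k) where

    open Zigzag m k m-multiple k-unit using (s; e; e-unit)

    solution : ∃ λ μ → μ < p × p ∣ s + μ * e
    solution = linearCongruence p-prime e-unit s

    open ZigzagWalk m k m-multiple k-unit (proj₁ solution) (proj₁ (proj₂ solution)) (proj₂ (proj₂ solution)) public

    realized : lengthVector n cycle ≡ mixed m k
    realized = trans (lengthVector-twoValued 1<n {cycle} (λ i → p ∣? suc (toℕ i)) lengthIndex-blockEnd lengthIndex-inner)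
      (Vec.tabulate-cong λ k′ → trans (cong₂ (λ a b → a * δ k k′ + b * δ m k′) blockEnds innerSteps)
                                      (+-comm (p * δ k k′) _))

  pure-isVertex : ∀ k → ¬ IsMultiple k → IsVertexEL n (pure k)
  pure-isVertex k k-unit = subst (IsVertexEL n) (pure-realized k k-unit) (vertexByFunctional 1<n (δ k) σ₀ bounded equality-case)
    where
    σ₀ = Uniform.cycle k k-unit
    weight : Permutation′ n → ℕ
    weight = cycleWeight 1<n (δ k)
    at-most-n : ∀ σ → weight σ ≤ n
    at-most-n σ = ≤-trans (∑-mono-≤ {g = λ _ → 1} (λ i → δ≤1 k (lengthIndex 1<n σ i))) (≤-reflexive (∑-one n))
    weight₀ : weight σ₀ ≡ n
    weight₀ = trans (sum-cong-≗ (λ i → trans (cong (δ k) (Uniform.uniform k k-unit i)) (δ-refl k))) (∑-one n)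
    bounded : ∀ σ → weight σ ≤ weight σ₀
    bounded σ = subst (weight σ ≤_) (sym weight₀) (at-most-n σ)
    equality-case : ∀ σ → weight σ₀ ≤ weight σ → lengthVector n σ ≡ lengthVector n σ₀
    equality-case σ heavy = trans (lengthVector-uniform 1<n {σ} {k} λ i → sym (δ≡1⇒≡ {k = k} (all-k i)))
                                  (sym (pure-realized k k-unit))
      where
      all-k : ∀ i → δ k (lengthIndex 1<n σ i) ≡ 1
      all-k = ∑-mono-≤-equality {g = λ _ → 1} (λ i → δ≤1 k (lengthIndex 1<n σ i))
                (subst (_≤ weight σ) (trans weight₀ (sym (∑-one n))) heavy)

  multipleCount unitCount : Permutation′ n → ℕ
  multipleCount σ = count (isMultiple? ∘ lengthIndex 1<n σ)
  unitCount σ     = count (¬? ∘ isMultiple? ∘ lengthIndex 1<n σ)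

  multipleCount+unitCount : ∀ σ → multipleCount σ + unitCount σ ≡ n
  multipleCount+unitCount σ = count-complement (isMultiple? ∘ lengthIndex 1<n σ)

  p≤unitCount : ∀ σ → p ≤ unitCount σ
  p≤unitCount σ = subst (p ≤_) (sum-cong-≗ relabel) (crossingEdges p∣n 1<p σ)
    where
    relabel : ∀ i → 𝟙 (¬? (p ∣? edgeLength n σ i)) ≡ 𝟙 (¬? (isMultiple? (lengthIndex 1<n σ i)))
    relabel i = cong (λ ℓ → 𝟙 (¬? (p ∣? ℓ))) (sym (suc-lengthIndex 1<n σ i))

  multipleCount≤n∸p : ∀ σ → multipleCount σ ≤ n ∸ p
  multipleCount≤n∸p σ = subst (_≤ n ∸ p) (m+n∸n≡m _ p)
    (∸-monoˡ-≤ p (subst (multipleCount σ + p ≤_) (multipleCount+unitCount σ)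
                        (+-monoʳ-≤ (multipleCount σ) (p≤unitCount σ))))

  -- e_k + 2 e_m is bounded edgewise by 1 + [p ∣ length], whose total is n + multipleCount σ ≤ 2n - p.
  module MixedFunctional (m k : Fin d) (m-multiple : IsMultiple m) (k-unit : ¬ IsMultiple k) where

    σ₀ : Permutation′ n
    σ₀ = Mixed.cycle m k m-multiple k-unit

    m≢k : m ≢ k
    m≢k refl = k-unit m-multiple

    g h : Fin d → ℕ
    g k′ = δ k k′ + 2 * δ m k′
    h k′ = 1 + 𝟙 (isMultiple? k′)

    g≤h : ∀ k′ → g k′ ≤ h k′
    g≤h k′ with m Fin.≟ k′
    ... | yes refl = ≤-reflexive (trans (cong₂ _+_ (δ-≢ (m≢k ∘ sym)) (cong (2 *_) (δ-refl m)))
                                        (cong suc (sym (𝟙-yes (isMultiple? m) m-multiple))))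
    ... | no m≢k′  = ≤-trans (≤-reflexive (trans (cong (λ x → δ k k′ + 2 * x) (δ-≢ m≢k′)) (+-identityʳ _)))
                             (≤-trans (δ≤1 k k′) (m≤m+n 1 _))

    top : ℕ
    top = n + (n ∸ p)

    h-weight : ∀ σ → cycleWeight 1<n h σ ≡ n + multipleCount σ
    h-weight σ = trans (ℕΣ.∑-distrib-+ (λ _ → 1) (λ i → 𝟙 (isMultiple? (lengthIndex 1<n σ i))))
                       (cong (_+ multipleCount σ) (∑-one n))

    h-weight≤top : ∀ σ → cycleWeight 1<n h σ ≤ top
    h-weight≤top σ = subst (_≤ top) (sym (h-weight σ)) (+-monoʳ-≤ n (multipleCount≤n∸p σ))

    g-profile : ∀ i → g (lengthIndex 1<n σ₀ i) ≡ (if does (p ∣? suc (toℕ i)) then 1 else 2)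
    g-profile i = by-position (p ∣? suc (toℕ i))
      where
      by-position : (end? : Dec (p ∣ suc (toℕ i))) → g (lengthIndex 1<n σ₀ i) ≡ (if does end? then 1 else 2)
      by-position (yes p∣) = trans (cong g (Mixed.lengthIndex-blockEnd m k m-multiple k-unit i p∣))
                               (cong₂ (λ a b → a + 2 * b) (δ-refl k) (δ-≢ m≢k))
      by-position (no p∤)  = trans (cong g (Mixed.lengthIndex-inner m k m-multiple k-unit i p∤))
                               (cong₂ (λ a b → a + 2 * b) (δ-≢ (m≢k ∘ sym)) (δ-refl m))

    g-weight₀ : cycleWeight 1<n g σ₀ ≡ top
    g-weight₀ = begin
      cycleWeight 1<n g σ₀                                    ≡⟨ sum-cong-≗ g-profile ⟩
      ∑[ i < n ] (if does (p ∣? suc (toℕ i)) then 1 else 2)   ≡⟨ ∑-if {n} (λ i → p ∣? suc (toℕ i)) 1 2 ⟩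
      count {n} (λ i → p ∣? suc (toℕ i)) * 1 + count {n} (λ i → ¬? (p ∣? suc (toℕ i))) * 2
                                                              ≡⟨ cong₂ (λ a b → a * 1 + b * 2) blockEnds innerSteps ⟩
      p * 1 + (n ∸ p) * 2                                     ≡⟨ solve 2 (λ a b → a :* con 1 :+ b :* con 2 := (a :+ b) :+ b) refl p (n ∸ p) ⟩
      (p + (n ∸ p)) + (n ∸ p)                                 ≡⟨ cong (_+ (n ∸ p)) (m+[n∸m]≡n (m≤m*n p p)) ⟩
      top                                                     ∎
      where open ≡-Reasoning

    bounded : ∀ σ → cycleWeight 1<n g σ ≤ cycleWeight 1<n g σ₀
    bounded σ = subst (cycleWeight 1<n g σ ≤_) (sym g-weight₀)
                      (≤-trans (∑-mono-≤ (g≤h ∘ lengthIndex 1<n σ)) (h-weight≤top σ))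

    tight-multiple : ∀ k′ → IsMultiple k′ → g k′ ≡ h k′ → k′ ≡ m
    tight-multiple k′ k′-multiple g≡h with m Fin.≟ k′
    ... | yes m≡k′ = sym m≡k′
    ... | no m≢k′  = contradiction (≤-trans (≤-reflexive h≡g) g≤1) (<⇒≱ (s≤s (s≤s z≤n)))
      where
      h≡g : 2 ≡ g k′
      h≡g = trans (cong suc (sym (𝟙-yes (isMultiple? k′) k′-multiple))) (sym g≡h)
      g≤1 : g k′ ≤ 1
      g≤1 = subst (_≤ 1) (sym (trans (cong (λ x → δ k k′ + 2 * x) (δ-≢ m≢k′)) (+-identityʳ _))) (δ≤1 k k′)

    tight-unit : ∀ k′ → ¬ IsMultiple k′ → g k′ ≡ h k′ → k′ ≡ k
    tight-unit k′ k′-unit g≡h = sym (δ≡1⇒≡ (begin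
      δ k k′                 ≡⟨ +-identityʳ _ ⟨
      δ k k′ + 2 * 0         ≡⟨ cong (λ x → δ k k′ + 2 * x) (δ-≢ m≢k′) ⟨
      g k′                   ≡⟨ g≡h ⟩
      1 + 𝟙 (isMultiple? k′) ≡⟨ cong suc (𝟙-no (isMultiple? k′) k′-unit) ⟩
      1                      ∎))
      where
      open ≡-Reasoning
      m≢k′ : m ≢ k′
      m≢k′ m≡k′ = k′-unit (subst IsMultiple m≡k′ m-multiple)

    equality-case : ∀ σ → cycleWeight 1<n g σ₀ ≤ cycleWeight 1<n g σ → lengthVector n σ ≡ lengthVector n σ₀
    equality-case σ heavy = begin
      lengthVector n σ
        ≡⟨ lengthVector-twoValued 1<n {σ} (isMultiple? ∘ idx) (λ i M → tight-multiple (idx i) M (tight i))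
                                                              (λ i ¬M → tight-unit (idx i) ¬M (tight i)) ⟩
      tabulate (λ k′ → multipleCount σ * δ m k′ + unitCount σ * δ k k′)
        ≡⟨ Vec.tabulate-cong (λ k′ → cong₂ (λ a b → a * δ m k′ + b * δ k k′) multiples-exact units-exact) ⟩
      mixed m k
        ≡⟨ Mixed.realized m k m-multiple k-unit ⟨
      lengthVector n σ₀ ∎
      where
      open ≡-Reasoning
      idx = lengthIndex 1<n σ
      top≤weight : top ≤ cycleWeight 1<n g σ
      top≤weight = subst (_≤ cycleWeight 1<n g σ) g-weight₀ heavy
      tight : ∀ i → g (idx i) ≡ h (idx i)
      tight = ∑-mono-≤-equality (g≤h ∘ idx) (≤-trans (h-weight≤top σ) top≤weight)
      multiples-exact : multipleCount σ ≡ n ∸ p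
      multiples-exact = ≤-antisym (multipleCount≤n∸p σ)
        (+-cancelˡ-≤ n _ _ (subst (top ≤_) (h-weight σ) (≤-trans top≤weight (∑-mono-≤ (g≤h ∘ idx)))))
      units-exact : unitCount σ ≡ p
      units-exact = trans (sym (m+n∸m≡n (multipleCount σ) _))
        (trans (cong (_∸ multipleCount σ) (multipleCount+unitCount σ))
          (trans (cong (n ∸_) multiples-exact) (m∸[m∸n]≡n (m≤m*n p p))))

  mixed-isVertex : ∀ m k → IsMultiple m → ¬ IsMultiple k → IsVertexEL n (mixed m k)
  mixed-isVertex m k m-multiple k-unit = subst (IsVertexEL n) (Mixed.realized m k m-multiple k-unit)
    (vertexByFunctional 1<n g σ₀ bounded equality-case)
    where open MixedFunctional m k m-multiple k-unit

  units multiples : List (Fin d)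
  units     = filter (¬? ∘ isMultiple?) (allFin d)
  multiples = filter isMultiple? (allFin d)

  candidates : List (Vec ℕ d)
  candidates = List.map pure units ++ cartesianProductWith mixed multiples units

  data Candidate : Vec ℕ d → Set where
    pureCandidate  : ∀ {k} → ¬ IsMultiple k → Candidate (pure k)
    mixedCandidate : ∀ {m k} → IsMultiple m → ¬ IsMultiple k → Candidate (mixed m k)

  candidate-view : ∀ {w} → w ∈ candidates → Candidate w
  candidate-view {w} w∈ with ∈-++⁻ (List.map pure units) w∈
  ... | inj₁ w∈pure with ∈-map⁻ pure w∈pure
  ...   | k , k∈ , refl = pureCandidate (proj₂ (∈-filter⁻ (¬? ∘ isMultiple?) {xs = allFin d} k∈))
  candidate-view {w} w∈ | inj₂ w∈mixed with ∈-cartesianProductWith⁻ mixed multiples units w∈mixed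
  ...   | m , k , m∈ , k∈ , refl = mixedCandidate (proj₂ (∈-filter⁻ isMultiple? {xs = allFin d} m∈))
                                                  (proj₂ (∈-filter⁻ (¬? ∘ isMultiple?) {xs = allFin d} k∈))

  candidate-isVertex : ∀ {w} → Candidate w → IsVertexEL n w
  candidate-isVertex (pureCandidate k-unit)             = pure-isVertex _ k-unit
  candidate-isVertex (mixedCandidate m-multiple k-unit) = mixed-isVertex _ _ m-multiple k-unit

  candidates-areVertices : All (IsVertexEL n) candidates
  candidates-areVertices = All.tabulate (candidate-isVertex ∘ candidate-view)

  -- Completeness

  dot-pure : ∀ c k (k-unit : ¬ IsMultiple k) → dot c (pure k) ≡ + n ℤ.* lookup c k
  dot-pure c k k-unit = begin
    dot c (pure k)                                ≡⟨ cong (dot c) (pure-realized k k-unit) ⟨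
    dot c (lengthVector n σ)                      ≡⟨ dot-lengthVector 1<n σ c ⟩
    ∑ℤ[ i < n ] lookup c (lengthIndex 1<n σ i)    ≡⟨ ℤΣ.sum-cong-≗ (λ i → cong (lookup c) (Uniform.uniform k k-unit i)) ⟩
    ∑ℤ[ i < n ] lookup c k                        ≡⟨ ∑ℤ-const n (lookup c k) ⟩
    + n ℤ.* lookup c k                            ∎
    where
    open ≡-Reasoning
    σ = Uniform.cycle k k-unit

  dot-mixed : ∀ c m k (m-multiple : IsMultiple m) (k-unit : ¬ IsMultiple k) →
              dot c (mixed m k) ≡ + p ℤ.* lookup c k ℤ.+ + (n ∸ p) ℤ.* lookup c m
  dot-mixed c m k m-multiple k-unit = begin
    dot c (mixed m k)                                ≡⟨ cong (dot c) (Mixed.realized m k m-multiple k-unit) ⟨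
    dot c (lengthVector n σ)                         ≡⟨ dot-lengthVector 1<n σ c ⟩
    ∑ℤ[ i < n ] lookup c (lengthIndex 1<n σ i)       ≡⟨ ℤΣ.sum-cong-≗ c-profile ⟩
    ∑ℤ[ i < n ] (if does (p ∣? suc (toℕ i)) then lookup c k else lookup c m)
                                                     ≡⟨ ∑ℤ-if {n} (λ i → p ∣? suc (toℕ i)) (lookup c k) (lookup c m) ⟩
    + count {n} (λ i → p ∣? suc (toℕ i)) ℤ.* lookup c k ℤ.+ + count {n} (λ i → ¬? (p ∣? suc (toℕ i))) ℤ.* lookup c m
                                                     ≡⟨ cong₂ (λ a b → + a ℤ.* lookup c k ℤ.+ + b ℤ.* lookup c m) blockEnds innerSteps ⟩
    + p ℤ.* lookup c k ℤ.+ + (n ∸ p) ℤ.* lookup c m  ∎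
    where
    open ≡-Reasoning
    σ = Mixed.cycle m k m-multiple k-unit
    c-profile : ∀ i → lookup c (lengthIndex 1<n σ i) ≡ (if does (p ∣? suc (toℕ i)) then lookup c k else lookup c m)
    c-profile i = by-position (p ∣? suc (toℕ i))
      where
      by-position : (end? : Dec (p ∣ suc (toℕ i))) →
                    lookup c (lengthIndex 1<n σ i) ≡ (if does end? then lookup c k else lookup c m)
      by-position (yes p∣) = cong (lookup c) (Mixed.lengthIndex-blockEnd m k m-multiple k-unit i p∣)
      by-position (no p∤)  = cong (lookup c) (Mixed.lengthIndex-inner m k m-multiple k-unit i p∤)

  envelope : ∀ c σ {kb mb} →
             (∀ k → ¬ IsMultiple k → lookup c k ℤ.≤ lookup c kb) → (∀ m → IsMultiple m → lookup c m ℤ.≤ lookup c mb) →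
             dot c (lengthVector n σ) ℤ.≤ + multipleCount σ ℤ.* lookup c mb ℤ.+ + unitCount σ ℤ.* lookup c kb
  envelope c σ {kb} {mb} kb-max mb-max = begin
    dot c (lengthVector n σ)      ≡⟨ dot-lengthVector 1<n σ c ⟩
    ∑ℤ[ i < n ] lookup c (idx i)  ≤⟨ ∑ℤ-mono-≤ bound ⟩
    ∑ℤ[ i < n ] (if does (isMultiple? (idx i)) then lookup c mb else lookup c kb)
                                  ≡⟨ ∑ℤ-if (isMultiple? ∘ idx) (lookup c mb) (lookup c kb) ⟩
    + multipleCount σ ℤ.* lookup c mb ℤ.+ + unitCount σ ℤ.* lookup c kb  ∎
    where
    open ℤ.≤-Reasoning
    idx = lengthIndex 1<n σ
    bound : ∀ i → lookup c (idx i) ℤ.≤ (if does (isMultiple? (idx i)) then lookup c mb else lookup c kb)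
    bound i with isMultiple? (idx i)
    ... | yes M = mb-max (idx i) M
    ... | no ¬M = kb-max (idx i) ¬M

  some-unit : ∃ λ k → ¬ IsMultiple k
  some-unit = fromℕ< (≤-trans (s≤s z≤n) (≤-trans (<⇒≤ 1<p) p≤d))
            , λ p∣1 → <⇒≱ 1<p (∣⇒≤ (subst (p ∣_) (cong suc (Fin.toℕ-fromℕ< _)) p∣1))

  some-multiple : ∃ IsMultiple
  some-multiple = fromℕ< (<-≤-trans (n<1+n (pred p)) (subst (_≤ d) (sym (suc-pred p)) p≤d))
                , subst (p ∣_) (sym (trans (cong suc (Fin.toℕ-fromℕ< _)) (suc-pred p))) ∣-refl

  unitCount-split : ∀ σ → unitCount σ ≡ p + (n ∸ p ∸ multipleCount σ)
  unitCount-split σ = +-cancelˡ-≡ A (unitCount σ) (p + e) (begin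
    A + unitCount σ ≡⟨ multipleCount+unitCount σ ⟩
    n               ≡⟨ m∸n+n≡m (m≤m*n p p) ⟨
    n ∸ p + p       ≡⟨ cong (_+ p) (m+[n∸m]≡n (multipleCount≤n∸p σ)) ⟨
    A + e + p       ≡⟨ +-assoc A e p ⟩
    A + (e + p)     ≡⟨ cong (_+_ A) (+-comm e p) ⟩
    A + (p + e)     ∎)
    where
    open ≡-Reasoning
    A = multipleCount σ
    e = n ∸ p ∸ A

  -- envelope bounds the value by A·cm + B·ck with A + B = n and B ≥ p; moving weight from the smaller
  -- of cm, ck to the larger one reaches the value of pure kb or of mixed mb kb.
  dominatingCandidate : ∀ c σ → ∃ λ w → w ∈ candidates × dot c (lengthVector n σ) ℤ.≤ dot c w
  dominatingCandidate c σ with argmaxOn (¬? ∘ isMultiple?) (lookup c) some-unit | argmaxOn isMultiple? (lookup c) some-multiple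
  ... | kb , kb-unit , kb-max | mb , mb-multiple , mb-max with lookup c mb ℤ.≤? lookup c kb
  ...   | yes cm≤ck = pure kb , ∈-++⁺ˡ (∈-map⁺ pure kb∈) , (begin
    dot c (lengthVector n σ)                                  ≤⟨ envelope c σ kb-max mb-max ⟩
    + A ℤ.* lookup c mb ℤ.+ + B ℤ.* lookup c kb               ≤⟨ reweigh-≤ A B cm≤ck ⟩
    + (A + B) ℤ.* lookup c kb                                 ≡⟨ cong (λ x → + x ℤ.* lookup c kb) (multipleCount+unitCount σ) ⟩
    + n ℤ.* lookup c kb                                       ≡⟨ dot-pure c kb kb-unit ⟨
    dot c (pure kb)                                           ∎)
    where
    open ℤ.≤-Reasoning
    A = multipleCount σ
    B = unitCount σ
    kb∈ = ∈-filter⁺ (¬? ∘ isMultiple?) (∈-allFin kb) kb-unit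
  ...   | no cm≰ck = mixed mb kb , ∈-++⁺ʳ (List.map pure units) (∈-cartesianProductWith⁺ mixed mb∈ kb∈) , (begin
    dot c (lengthVector n σ)                                  ≤⟨ envelope c σ kb-max mb-max ⟩
    + A ℤ.* lookup c mb ℤ.+ + B ℤ.* lookup c kb               ≡⟨ cong (λ x → + A ℤ.* cm ℤ.+ + x ℤ.* ck) (unitCount-split σ) ⟩
    + A ℤ.* lookup c mb ℤ.+ + (p + e) ℤ.* lookup c kb         ≤⟨ shift-≤ A p e (ℤ.<⇒≤ (ℤ.≰⇒> cm≰ck)) ⟩
    + (A + e) ℤ.* lookup c mb ℤ.+ + p ℤ.* lookup c kb         ≡⟨ cong (λ x → + x ℤ.* cm ℤ.+ + p ℤ.* ck) A+e≡n∸p ⟩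
    + (n ∸ p) ℤ.* lookup c mb ℤ.+ + p ℤ.* lookup c kb         ≡⟨ ℤ.+-comm (+ (n ∸ p) ℤ.* cm) (+ p ℤ.* ck) ⟩
    + p ℤ.* lookup c kb ℤ.+ + (n ∸ p) ℤ.* lookup c mb         ≡⟨ dot-mixed c mb kb mb-multiple kb-unit ⟨
    dot c (mixed mb kb)                                       ∎)
    where
    open ℤ.≤-Reasoning
    A = multipleCount σ
    B = unitCount σ
    e = n ∸ p ∸ A
    ck = lookup c kb
    cm = lookup c mb
    kb∈ = ∈-filter⁺ (¬? ∘ isMultiple?) (∈-allFin kb) kb-unit
    mb∈ = ∈-filter⁺ isMultiple? (∈-allFin mb) mb-multiple
    A+e≡n∸p : A + e ≡ n ∸ p
    A+e≡n∸p = m+[n∸m]≡n (multipleCount≤n∸p σ)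

  complete : ∀ v → IsVertexEL n v → v ∈ candidates
  complete v ((σ₀ , refl) , c , strict) with dominatingCandidate c σ₀
  ... | w , w∈ , v≤w with Vec.≡-dec ℕ._≟_ w (lengthVector n σ₀)
  ...   | yes refl = w∈
  ...   | no w≢v   = contradiction v≤w (ℤ.<⇒≱ (subst (ℤ._< dot c (lengthVector n σ₀)) (cong (dot c) σw≡w)
                                                 (strict σw (λ eq → w≢v (trans (sym σw≡w) eq)))))
    where
    σw = proj₁ (proj₁ (All.lookup candidates-areVertices w∈))
    σw≡w = proj₂ (proj₁ (All.lookup candidates-areVertices w∈))

  -- Uniqueness and counting

  lookup-mixed : ∀ m k k′ → lookup (mixed m k) k′ ≡ (n ∸ p) * δ m k′ + p * δ k k′
  lookup-mixed m k k′ = Vec.lookup∘tabulate _ k′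

  pure-injective : ∀ {k k′} → pure k ≡ pure k′ → k ≡ k′
  pure-injective {k} {k′} eq = sym (δ≡1⇒≡ (sym (*-cancelˡ-≡ 1 (δ k′ k) n (begin
    n * 1               ≡⟨ cong (n *_) (δ-refl k) ⟨
    n * δ k k           ≡⟨ Vec.lookup∘tabulate _ k ⟨
    lookup (pure k) k   ≡⟨ cong (λ w → lookup w k) eq ⟩
    lookup (pure k′) k  ≡⟨ Vec.lookup∘tabulate _ k ⟩
    n * δ k′ k          ∎))))
    where open ≡-Reasoning

  mixed-injective : ∀ {m k m′ k′} → mixed m k ≡ mixed m′ k′ → m ≡ m′ × k ≡ k′
  mixed-injective {m} {k} {m′} {k′} eq = same-m , same-k
    where
    at : ∀ k″ → (n ∸ p) * δ m k″ + p * δ k k″ ≡ (n ∸ p) * δ m′ k″ + p * δ k′ k″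
    at k″ = trans (sym (lookup-mixed m k k″)) (trans (cong (λ w → lookup w k″) eq) (lookup-mixed m′ k′ k″))
    same-m : m ≡ m′
    same-m with m′ Fin.≟ m
    ... | yes m′≡m = sym m′≡m
    ... | no m′≢m  = contradiction (begin-strict
      n ∸ p                          ≡⟨ *-identityʳ (n ∸ p) ⟨
      (n ∸ p) * 1                    ≡⟨ cong ((n ∸ p) *_) (δ-refl m) ⟨
      (n ∸ p) * δ m m                ≤⟨ m≤m+n _ _ ⟩
      (n ∸ p) * δ m m + p * δ k m    ≡⟨ at m ⟩
      (n ∸ p) * δ m′ m + p * δ k′ m  ≡⟨ cong (λ x → (n ∸ p) * x + p * δ k′ m) (δ-≢ m′≢m) ⟩
      (n ∸ p) * 0 + p * δ k′ m       ≡⟨ cong (_+ p * δ k′ m) (*-zeroʳ (n ∸ p)) ⟩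
      p * δ k′ m                     ≤⟨ *-monoʳ-≤ p (δ≤1 k′ m) ⟩
      p * 1                          ≡⟨ *-identityʳ p ⟩
      p                              <⟨ p<n∸p ⟩
      n ∸ p                          ∎) (<-irrefl refl)
      where open ≤-Reasoning
    same-k : k ≡ k′
    same-k = sym (δ≡1⇒≡ (sym (*-cancelˡ-≡ 1 (δ k′ k) p (begin
      p * 1       ≡⟨ cong (p *_) (δ-refl k) ⟨
      p * δ k k   ≡⟨ +-cancelˡ-≡ _ _ _ (trans (at k) (cong (λ x → (n ∸ p) * δ x k + p * δ k′ k) (sym same-m))) ⟩
      p * δ k′ k  ∎))))
      where open ≡-Reasoning

  pure≢mixed : ∀ {k m k′} → m ≢ k′ → pure k ≢ mixed m k′
  pure≢mixed {k} {m} {k′} m≢k′ eq = value-of (k Fin.≟ k′) at-k′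
    where
    at-k′ : n * δ k k′ ≡ p
    at-k′ = begin
      n * δ k k′                       ≡⟨ Vec.lookup∘tabulate _ k′ ⟨
      lookup (pure k) k′               ≡⟨ cong (λ w → lookup w k′) eq ⟩
      lookup (mixed m k′) k′           ≡⟨ lookup-mixed m k′ k′ ⟩
      (n ∸ p) * δ m k′ + p * δ k′ k′   ≡⟨ cong₂ (λ a b → (n ∸ p) * a + p * b) (δ-≢ m≢k′) (δ-refl k′) ⟩
      (n ∸ p) * 0 + p * 1              ≡⟨ cong₂ _+_ (*-zeroʳ (n ∸ p)) (*-identityʳ p) ⟩
      p                                ∎
      where open ≡-Reasoning
    value-of : Dec (k ≡ k′) → n * δ k k′ ≢ p
    value-of (yes refl) n*δ≡p = <⇒≢ (<-trans (m<m+n p (>-nonZero⁻¹ p)) p+p<n)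
                                    (sym (trans (sym (*-identityʳ n)) (trans (cong (n *_) (sym (δ-refl k))) n*δ≡p)))
    value-of (no k≢k′)  n*δ≡p = <⇒≢ (>-nonZero⁻¹ p)
                                    (trans (sym (*-zeroʳ n)) (trans (cong (n *_) (sym (δ-≢ k≢k′))) n*δ≡p))

  disjoint : Disjoint (List.map pure units) (cartesianProductWith mixed multiples units)
  disjoint (v∈pure , v∈mixed) with ∈-map⁻ pure v∈pure | ∈-cartesianProductWith⁻ mixed multiples units v∈mixed
  ... | k , _ , refl | m , k′ , m∈ , k′∈ , eq = pure≢mixed {k} m≢k′ eq
    where
    m≢k′ : m ≢ k′
    m≢k′ refl = proj₂ (∈-filter⁻ (¬? ∘ isMultiple?) {xs = allFin d} k′∈)
                      (proj₂ (∈-filter⁻ isMultiple? {xs = allFin d} m∈))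

  candidates-unique : Unique candidates
  candidates-unique = Unique.++⁺
    (Unique.map⁺ pure-injective (Unique.filter⁺ (¬? ∘ isMultiple?) (Unique.allFin⁺ d)))
    (Unique.cartesianProductWith⁺ mixed mixed-injective (Unique.filter⁺ isMultiple? (Unique.allFin⁺ d))
                                                          (Unique.filter⁺ (¬? ∘ isMultiple?) (Unique.allFin⁺ d)))
    disjoint

  h : ℕ
  h = half p

  p≡1+h*2 : p ≡ 1 + h * 2
  p≡1+h*2 = trans (m≡m%n+[m/n]*n p 2) (cong (_+ h * 2) p%2≡1)
    where
    p%2≡1 : p % 2 ≡ 1
    p%2≡1 with p % 2 in p%2 | m%n<n p 2
    ... | 0           | _             = contradiction (m%n≡0⇒n∣m p 2 p%2) p-odd
    ... | 1           | _             = refl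
    ... | suc (suc _) | s≤s (s≤s ())

  d≡h*p+h : d ≡ h * p + h
  d≡h*p+h = trans (cong half n≡) ([r+q*m]/m≡q {q = h * p + h} (s≤s (s≤s z≤n)))
    where
    n≡ : n ≡ 1 + (h * p + h) * 2
    n≡ = begin
      p * p                       ≡⟨ cong (p *_) p≡1+h*2 ⟩
      p * (1 + h * 2)             ≡⟨ solve 2 (λ p h → p :* (con 1 :+ h :* con 2) := p :+ h :* p :* con 2) refl p h ⟩
      p + h * p * 2               ≡⟨ cong (_+ h * p * 2) p≡1+h*2 ⟩
      1 + h * 2 + h * p * 2       ≡⟨ solve 2 (λ h q → con 1 :+ h :* con 2 :+ q :* con 2 := con 1 :+ (q :+ h) :* con 2) refl h (h * p) ⟩
      1 + (h * p + h) * 2         ∎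
      where open ≡-Reasoning

  length-multiples : length multiples ≡ h
  length-multiples = trans (length-filter-tabulate isMultiple? id)
    (trans (cong (countMultiples p) d≡h*p+h) (countMultiples-quotient p h (m/n<m p 2 (s≤s (s≤s z≤n)))))

  length-units : length units ≡ h * p
  length-units = +-cancelˡ-≡ h _ _ (begin
    h + length units                              ≡⟨ cong₂ _+_ (trans (sym length-multiples) (length-filter-tabulate isMultiple? id))
                                                               (length-filter-tabulate (¬? ∘ isMultiple?) id) ⟩
    count isMultiple? + count (¬? ∘ isMultiple?)  ≡⟨ count-complement isMultiple? ⟩
    d                                             ≡⟨ d≡h*p+h ⟩
    h * p + h                                     ≡⟨ +-comm (h * p) h ⟩
    h + h * p                                     ∎)
    where open ≡-Reasoning

  length-candidates : length candidates ≡ (p ^ 3 ∸ p) / 4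
  length-candidates = begin
    length candidates                                   ≡⟨ length-++ (List.map pure units) ⟩
    length (List.map pure units) + length (cartesianProductWith mixed multiples units)
                                                        ≡⟨ cong₂ _+_ (length-map pure units) (length-cartesianProductWith mixed multiples units) ⟩
    length units + length multiples * length units      ≡⟨ cong₂ (λ u m → u + m * u) length-units length-multiples ⟩
    h * p + h * (h * p)                                 ≡⟨ m*n/n≡m (h * p + h * (h * p)) 4 ⟨
    (h * p + h * (h * p)) * 4 / 4                       ≡⟨ cong (_/ 4) (m+n∸n≡m _ p) ⟨
    ((h * p + h * (h * p)) * 4 + p ∸ p) / 4             ≡⟨ cong (λ x → (x ∸ p) / 4) cube ⟨
    (p ^ 3 ∸ p) / 4                                     ∎
    where
    open ≡-Reasoning
    cube : p ^ 3 ≡ (h * p + h * (h * p)) * 4 + p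
    cube = subst (λ q → q ^ 3 ≡ (h * q + h * (h * q)) * 4 + q) (sym p≡1+h*2)
      (solve 1 (λ h → (con 1 :+ h :* con 2) :^ 3 := (h :* (con 1 :+ h :* con 2) :+ h :* (h :* (con 1 :+ h :* con 2))) :* con 4
                      :+ (con 1 :+ h :* con 2)) refl h)

mainTheorem3 : ∀ (p : ℕ) → Prime p → 3 ≤ p →
    ∃ λ (vs : List (Vec ℕ (half (p * p)))) →
      Unique vs × All (IsVertexEL (p * p)) vs ×
      (∀ v → IsVertexEL (p * p) v → v ∈ vs) ×
      length vs ≡ (p ^ 3 ∸ p) / 4
mainTheorem3 p p-prime 3≤p = candidates , candidates-unique , candidates-areVertices , complete , length-candidates
  where open Square p p-prime 3≤p
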